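{- Let $G$ be a star on $k$ vertices and $n\ge1$. Then \[ W(\Gamma^G_n) = \frac{(k-1)^2(2k^2-2k-1)}{k^3(2k-1)}\cdot 2^nk^{2n} - \frac{(k-1)(k-2)}{k^2}\cdot k^{2n} + \frac{(k-1)(k-2)}{k^2(2k-1)}\cdot k^n . \]
   Context: Let $G$ be a finite tree with vertex set $V$, $|V|=k$, and fix an orientation of each edge. For an oriented edge $e=(s,t)$ of $G$ define a bijection $e$ of the set $V^n$ of words of length $n$ over $V$ recursively: $e$ fixes the empty word, and for a letter $z\in V$ and a word $w$, $e(sw)=t\,e(w)$, $e(tw)=sw$, and $e(zw)=zw$ for $z\notin\{s,t\}$. The $n$-th Schreier graph $\Gamma^G_n$ is the graph with vertex set $V^n$ in which, for each word $u\in V^n$ and each edge $e$ of $G$, $u$ is joined to $e(u)$ by an edge labelled $e$. The Wiener index $W(H)$ is the sum of graph distances over all unordered pairs of vertices of $H$. A star on $k$ vertices is the tree with one vertex adjacent to all other $k-1$ vertices. -}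

module Defs where

open import Data.Nat as N using (ℕ; zero; suc; _≤_; NonZero)
open import Data.Nat.Properties using (m*n≢0; m^n≢0)
import Data.Nat.Properties
open import Data.Integer as Z using (ℤ; +_)
open import Data.Rational as Q using (ℚ; _/_)
open import Data.Fin using (Fin)
open import Data.Vec using (Vec; []; _∷_)
open import Data.List using (List; []; _∷_; map; concatMap)
open import Data.Nat.ListAction using (sum)
open import Data.List.Base using (allFin) renaming ([_] to [_]ₗ)
open import Data.Bool using (Bool; true; false)
open import Data.Product using (Σ; Σ-syntax; ∃; _×_; _,_)
open import Data.Sum using (_⊎_)
open import Relation.Binary.PropositionalEquality using (_≡_; _≢_)
open import Relation.Nullary using (Dec; yes; no)
open import Data.Fin using (_≟_)

Word : ℕ → ℕ → Set
Word k n = Vec (Fin k) n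

act : ∀ {k n} → Fin k → Fin k → Word k n → Word k n
act s t [] = []
act s t (z ∷ w) with z ≟ s
... | yes _ = t ∷ act s t w
... | no _ with z ≟ t
...   | yes _ = s ∷ w
...   | no _ = z ∷ w

-- The star on k vertices with centre c; the edge {c , v} (v ≢ c) is
-- oriented as (c , v) if o v ≡ true and as (v , c) if o v ≡ false.

orient : ∀ {k} → Bool → Fin k → Fin k → Fin k × Fin k
orient true  c v = c , v
orient false c v = v , c

StarEdge : ∀ {k} → Fin k → (Fin k → Bool) → Fin k × Fin k → Set
StarEdge c o e = Σ[ v ∈ _ ] (v ≢ c × e ≡ orient (o v) c v)

-- Schreier graph Γ_n for a tree given by its set of oriented edges:
-- u is joined to e(u) for every word u and every edge e.
-- (Undirected) adjacency:

SchreierAdj : ∀ {k} → (Fin k × Fin k → Set) → ∀ n → Word k n → Word k n → Set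
SchreierAdj {k} Edge n u w =
  Σ[ s ∈ Fin k ] Σ[ t ∈ Fin k ] (Edge (s , t) × (act s t u ≡ w ⊎ act s t w ≡ u))

data Walk {A : Set} (Adj : A → A → Set) : A → A → ℕ → Set where
  here : ∀ {u} → Walk Adj u u 0
  step : ∀ {u v w m} → Adj u v → Walk Adj v w m → Walk Adj u w (suc m)

-- D is the graph distance: D u v is the length of a shortest walk from u to v
-- (in particular the graph is connected).
IsDistance : {A : Set} → (A → A → Set) → (A → A → ℕ) → Set
IsDistance Adj D =
  ∀ u v → Walk Adj u v (D u v) × (∀ m → Walk Adj u v m → D u v ≤ m)

allWords : ∀ k n → List (Word k n)
allWords k zero = [ [] ]ₗ
allWords k (suc n) = concatMap (λ a → map (a ∷_) (allWords k n)) (allFin k)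

pairSum : {A : Set} → (A → A → ℕ) → List A → ℕ
pairSum f [] = 0
pairSum f (x ∷ xs) = sum (map (f x) xs) + pairSum f xs
  where open N using (_+_)

wiener : ∀ k n → (Word k n → Word k n → ℕ) → ℕ
wiener k n D = pairSum D (allWords k n)

nz₁ : ∀ k → .{{NonZero k}} → NonZero (k N.^ 3 N.* (2 N.* k N.∸ 1))
nz₁ (suc m) = m*n≢0 (suc m N.^ 3) (2 N.* suc m N.∸ 1) {{m^n≢0 (suc m) 3}} {{nz₂ m}}
  where
  nz₂ : ∀ m → NonZero (2 N.* suc m N.∸ 1)
  nz₂ m rewrite Data.Nat.Properties.+-suc m (m N.+ 0) = _

nz₃ : ∀ k → .{{NonZero k}} → NonZero (k N.^ 2)
nz₃ (suc m) = m^n≢0 (suc m) 2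

nz₄ : ∀ k → .{{NonZero k}} → NonZero (k N.^ 2 N.* (2 N.* k N.∸ 1))
nz₄ (suc m) = m*n≢0 (suc m N.^ 2) (2 N.* suc m N.∸ 1) {{m^n≢0 (suc m) 2}} {{nz₂ m}}
  where
  nz₂ : ∀ m → NonZero (2 N.* suc m N.∸ 1)
  nz₂ m rewrite Data.Nat.Properties.+-suc m (m N.+ 0) = _

formula : ∀ k → .{{NonZero k}} → ℕ → ℚ
formula k n =
    _/_ ((K - one) ^ 2 * (two * K ^ 2 - two * K - one)) (k N.^ 3 N.* (2 N.* k N.∸ 1)) {{nz₁ k}}
      Q.* ((+ (2 N.^ n N.* k N.^ (2 N.* n))) / 1)
  Q.- _/_ ((K - one) * (K - two)) (k N.^ 2) {{nz₃ k}} Q.* ((+ (k N.^ (2 N.* n))) / 1)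
  Q.+ _/_ ((K - one) * (K - two)) (k N.^ 2 N.* (2 N.* k N.∸ 1)) {{nz₄ k}} Q.* ((+ (k N.^ n)) / 1)
  where
  open Z using (_-_; _*_; _^_)
  K one two : ℤ
  K = + k
  one = + 1
  two = + 2

{-# OPTIONS --safe #-}

-- Write c for the centre and g v = act v c for the generator of the edge {c , v}.  In Γ(n+1) the word
-- c ∷ x is joined to every v ∷ x, and v ∷ x is joined to c ∷ g v x: every vertex x of Γ(n) becomes a star
-- and every edge x ─ g v x a path of length two through the leaf v ∷ x.  So the distance of Γ(n+1) is
-- computed from that of Γ(n) by the recursion dist below; it changes by at most one along an edge and has
-- the parity of the bipartition of words by their first letter (c or a leaf), which makes it the graph
-- distance.
--
-- Summing the recursion over all pairs of words expresses the total distance T(n+1) through T(n), the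
-- total distance P(n) from vertices to edges and the total distance Q(n) between edges.  Since the two ends
-- of an edge that is not a loop are at distances differing by exactly one from any vertex,
-- 2 min(a , b) = a + b - 1 eliminates P and Q up to the number of ties: pairs of edges (e , f) such that
-- both ends of e are equally far from f.
-- Splitting the edges of Γ(n+1) over those of Γ(n), and shifting all distances by their minimum to reach a
-- finite check, shows that there are twice as many ties as edges that are not loops.  What remains is a
-- linear recurrence for T, and W = T / 2.

module Submission where

open import Defs
open import Data.Bool using (Bool; true; false)
open import Data.Fin as Fin using (Fin; zero; suc; punchIn; toℕ; fromℕ<; _≟_)
open import Data.Fin.Properties using (punchInᵢ≢i; punchIn-injective; punchIn-punchOut; toℕ-fromℕ<; all?)
import Data.Fin.Permutation as Perm
import Data.Fin.Permutation.Components as PC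
open import Data.List as List using (List; []; _∷_; map; concatMap; allFin; tabulate)
open import Data.List.Properties using (map-tabulate; map-++; map-∘; map-cong)
open import Data.Nat as ℕ using (ℕ; zero; suc; _+_; _*_; _∸_; _^_; _⊓_; _≤_; s≤s; NonZero)
open import Data.Nat.Divisibility using (_∣_; divides; ∣m∣n⇒∣m+n; ∣m+n∣m⇒∣n; ∣1⇒≡1; m∣m*n)
open import Data.Nat.ListAction using (sum)
open import Data.Nat.Tactic.RingSolver using (solve-∀)
open import Data.Nat.ListAction.Properties using (sum-++)
open import Data.Nat.Properties hiding (_≟_)
open import Algebra.Properties.CommutativeSemigroup +-commutativeSemigroup
  using () renaming (interchange to +-interchange)
open import Algebra.Properties.CommutativeSemigroup ⊓-commutativeSemigroup
  using () renaming (interchange to ⊓-interchange)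
open import Algebra.Properties.Semiring.Sum +-*-semiring
  using (sum-syntax; sum-cong-≗; ∑-distrib-+; ∑-comm; sum-remove; ∑-permute; *-distribˡ-sum)
  renaming (sum to ∑)
open import Data.Product using (Σ-syntax; _×_; _,_; proj₁; proj₂)
open import Data.Sum as Sum using (_⊎_; inj₁; inj₂)
open import Data.Vec using (Vec; []; _∷_)
open import Data.Vec.Properties using (∷-injective) renaming (≡-dec to ≡-dec-Vec)
open import Function using (_∘_)
open import Relation.Binary.PropositionalEquality
open import Relation.Nullary using (Dec; yes; no; ¬_; contradiction)
open import Relation.Nullary.Decidable using (_×-dec_; _→-dec_; ¬?; True; toWitness; dec-true; dec-false)
open ≡-Reasoning

private
  variable
    A B : Set
    k n : ℕ

𝟙[_] : {P : Set} → Dec P → ℕ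
𝟙[ yes _ ] = 1
𝟙[ no _ ] = 0

𝟙-yes : {P : Set} (d : Dec P) → P → 𝟙[ d ] ≡ 1
𝟙-yes (yes _) _ = refl
𝟙-yes (no ¬p) p = contradiction p ¬p

𝟙-no : {P : Set} (d : Dec P) → ¬ P → 𝟙[ d ] ≡ 0
𝟙-no (yes p) ¬p = contradiction p ¬p
𝟙-no (no _) _ = refl

𝟙-⇔ : {P Q : Set} → (P → Q) → (Q → P) → (d : Dec P) (e : Dec Q) → 𝟙[ d ] ≡ 𝟙[ e ]
𝟙-⇔ to from (yes p) e = sym (𝟙-yes e (to p))
𝟙-⇔ to from (no ¬p) e = sym (𝟙-no e (¬p ∘ from))

𝟙-× : {P Q : Set} (d : Dec P) (e : Dec Q) → 𝟙[ d ×-dec e ] ≡ 𝟙[ d ] * 𝟙[ e ]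
𝟙-× (yes _) (yes _) = refl
𝟙-× (yes _) (no _) = refl
𝟙-× (no _) _ = refl

𝟙-≟-shift : ∀ q {x y x′ y′} → x ≡ q + x′ → y ≡ q + y′ → 𝟙[ x ℕ.≟ y ] ≡ 𝟙[ x′ ℕ.≟ y′ ]
𝟙-≟-shift q refl refl = 𝟙-⇔ (+-cancelˡ-≡ q _ _) (cong (q +_)) (q + _ ℕ.≟ q + _) (_ ℕ.≟ _)

𝟙-≟-cong : ∀ {x y x′ y′} → x ≡ x′ → y ≡ y′ → 𝟙[ x ℕ.≟ y ] ≡ 𝟙[ x′ ℕ.≟ y′ ]
𝟙-≟-cong refl refl = refl

sum-map-+ : (f g : A → ℕ) (xs : List A) →
  sum (map (λ x → f x + g x) xs) ≡ sum (map f xs) + sum (map g xs)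
sum-map-+ f g [] = refl
sum-map-+ f g (x ∷ xs) =
  trans (cong (f x + g x +_) (sum-map-+ f g xs)) (+-interchange (f x) (g x) _ _)

sum-map-concatMap : (f : A → ℕ) (h : B → List A) (xs : List B) →
  sum (map f (concatMap h xs)) ≡ sum (map (λ x → sum (map f (h x))) xs)
sum-map-concatMap f h [] = refl
sum-map-concatMap f h (x ∷ xs) = begin
  sum (map f (h x List.++ concatMap h xs))
    ≡⟨ cong sum (map-++ f (h x) (concatMap h xs)) ⟩
  sum (map f (h x) List.++ map f (concatMap h xs))
    ≡⟨ sum-++ (map f (h x)) _ ⟩
  sum (map f (h x)) + sum (map f (concatMap h xs))
    ≡⟨ cong (sum (map f (h x)) +_) (sum-map-concatMap f h xs) ⟩
  sum (map f (h x)) + sum (map (λ x → sum (map f (h x))) xs) ∎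

sum-map-allFin : (f : Fin n → ℕ) → sum (map f (allFin n)) ≡ ∑[ i < n ] f i
sum-map-allFin {n} f = trans (cong sum (map-tabulate (λ i → i) f)) (sum-tabulate n f)
  where
  sum-tabulate : ∀ n (f : Fin n → ℕ) → sum (tabulate f) ≡ ∑[ i < n ] f i
  sum-tabulate zero f = refl
  sum-tabulate (suc n) f = cong (f zero +_) (sum-tabulate n (f ∘ suc))

pairSum-double : (D : A → A → ℕ) → (∀ x y → D x y ≡ D y x) → (∀ x → D x x ≡ 0) →
  ∀ xs → 2 * pairSum D xs ≡ sum (map (λ x → sum (map (D x) xs)) xs)
pairSum-double D D-sym D-refl [] = refl
pairSum-double D D-sym D-refl (x ∷ xs) = begin
  2 * (Sx + pairSum D xs)                         ≡⟨ double-+ Sx (pairSum D xs) ⟩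
  Sx + (Sx + 2 * pairSum D xs)                    ≡⟨ cong (λ t → Sx + (Sx + t)) (pairSum-double D D-sym D-refl xs) ⟩
  Sx + (Sx + R)
    ≡⟨ cong₂ (λ a b → a + (b + R)) (cong (_+ Sx) (sym (D-refl x))) (sym column) ⟩
  D x x + Sx + (sum (map (λ y → D y x) xs) + R)
    ≡⟨ cong (D x x + Sx +_) (sym (sum-map-+ (λ y → D y x) (λ y → sum (map (D y) xs)) xs)) ⟩
  sum (map (λ y → sum (map (D y) (x ∷ xs))) (x ∷ xs)) ∎
  where
  Sx = sum (map (D x) xs)
  R = sum (map (λ y → sum (map (D y) xs)) xs)
  column : sum (map (λ y → D y x) xs) ≡ Sx
  column = cong sum (map-cong (λ y → D-sym y x) xs)
  double-+ : ∀ a b → 2 * (a + b) ≡ a + (a + 2 * b)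
  double-+ = solve-∀

∑-const : ∀ n m → ∑[ i < n ] m ≡ n * m
∑-const zero m = refl
∑-const (suc n) m = cong (m +_) (∑-const n m)

∑-zero : (f : Fin n → ℕ) → (∀ i → f i ≡ 0) → ∑ f ≡ 0
∑-zero {n} f f≡0 = trans (sum-cong-≗ f≡0) (trans (∑-const n 0) (*-zeroʳ n))

∑-single : (i : Fin n) (f : Fin n → ℕ) → (∀ j → j ≢ i → f j ≡ 0) → ∑ f ≡ f i
∑-single {suc n} i f vanishes = begin
  ∑ f                                   ≡⟨ sum-remove {i = i} f ⟩
  f i + ∑[ j < n ] f (punchIn i j)      ≡⟨ cong (f i +_) (∑-zero _ (λ j → vanishes _ (punchInᵢ≢i i j))) ⟩
  f i + 0                               ≡⟨ +-identityʳ (f i) ⟩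
  f i                                   ∎

∑-δ : (i : Fin n) → ∑[ j < n ] 𝟙[ i ≟ j ] ≡ 1
∑-δ i = trans (∑-single i _ (λ j j≢i → 𝟙-no (i ≟ j) (j≢i ∘ sym))) (𝟙-yes (i ≟ i) refl)

module _ {i j : Fin n} where

  transpose-source : PC.transpose i j i ≡ j
  transpose-source rewrite dec-true (i ≟ i) refl = refl

  transpose-target : i ≢ j → PC.transpose i j j ≡ i
  transpose-target i≢j rewrite dec-false (j ≟ i) (i≢j ∘ sym) | dec-true (j ≟ j) refl = refl

  transpose-other : ∀ {a} → a ≢ i → a ≢ j → PC.transpose i j a ≡ a
  transpose-other {a} a≢i a≢j rewrite dec-false (a ≟ i) a≢i | dec-false (a ≟ j) a≢j = refl

∑-transpose : (i j : Fin n) (f : Fin n → ℕ) → ∑ f ≡ ∑[ a < n ] f (PC.transpose i j a)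
∑-transpose i j f = ∑-permute f (Perm.transpose i j)

infix 4 _≟ʷ_
_≟ʷ_ : (x y : Word k n) → Dec (x ≡ y)
_≟ʷ_ = ≡-dec-Vec _≟_

∑ʷ : (Word k n → ℕ) → ℕ
∑ʷ {n = zero} F = F []
∑ʷ {k} {suc n} F = ∑[ a < k ] ∑ʷ (λ y → F (a ∷ y))

-- ∑ʷ[ x ∶ n ] names the length n of the words when it cannot be inferred.
∑ʷ-syntax : ∀ n → (Word k n → ℕ) → ℕ
∑ʷ-syntax n = ∑ʷ

infixl 10 ∑ʷ ∑ʷ-syntax
syntax ∑ʷ (λ x → e) = ∑ʷ[ x ] e
syntax ∑ʷ-syntax n (λ x → e) = ∑ʷ[ x ∶ n ] e

∑ʷ-cong : {F G : Word k n → ℕ} → (∀ x → F x ≡ G x) → ∑ʷ F ≡ ∑ʷ G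
∑ʷ-cong {n = zero} F≡G = F≡G []
∑ʷ-cong {n = suc n} F≡G = sum-cong-≗ (λ a → ∑ʷ-cong (λ y → F≡G (a ∷ y)))

∑ʷ-distrib-+ : (F G : Word k n → ℕ) → ∑ʷ[ x ] (F x + G x) ≡ ∑ʷ F + ∑ʷ G
∑ʷ-distrib-+ {n = zero} F G = refl
∑ʷ-distrib-+ {n = suc n} F G =
  trans (sum-cong-≗ (λ a → ∑ʷ-distrib-+ (λ y → F (a ∷ y)) (λ y → G (a ∷ y))))
        (∑-distrib-+ (λ a → ∑ʷ (λ y → F (a ∷ y))) (λ a → ∑ʷ (λ y → G (a ∷ y))))

*-distribˡ-∑ʷ : ∀ m (F : Word k n → ℕ) → m * ∑ʷ F ≡ ∑ʷ[ x ] (m * F x)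
*-distribˡ-∑ʷ {n = zero} m F = refl
*-distribˡ-∑ʷ {n = suc n} m F =
  trans (*-distribˡ-sum m (λ a → ∑ʷ (λ y → F (a ∷ y))))
        (sum-cong-≗ (λ a → *-distribˡ-∑ʷ m (λ y → F (a ∷ y))))

∑ʷ-const : ∀ k n m → ∑ʷ {k} {n} (λ _ → m) ≡ k ^ n * m
∑ʷ-const k zero m = sym (*-identityˡ m)
∑ʷ-const k (suc n) m = begin
  ∑[ a < k ] ∑ʷ {k} {n} (λ _ → m) ≡⟨ sum-cong-≗ {k} (λ _ → ∑ʷ-const k n m) ⟩
  ∑[ a < k ] (k ^ n * m)          ≡⟨ ∑-const k (k ^ n * m) ⟩
  k * (k ^ n * m)                 ≡⟨ *-assoc k (k ^ n) m ⟨
  k ^ suc n * m                   ∎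

∑ʷ-affine : ∀ a b (F : Word k n → ℕ) → ∑ʷ[ x ] (a + b * F x) ≡ k ^ n * a + b * ∑ʷ F
∑ʷ-affine {k} {n} a b F = trans (∑ʷ-distrib-+ (λ _ → a) (λ x → b * F x))
                                (cong₂ _+_ (∑ʷ-const k n a) (sym (*-distribˡ-∑ʷ b F)))

∑-∑ʷ-comm : ∀ m (F : Fin m → Word k n → ℕ) → ∑[ i < m ] ∑ʷ (F i) ≡ ∑ʷ[ x ] ∑[ i < m ] F i x
∑-∑ʷ-comm {n = zero} m F = refl
∑-∑ʷ-comm {k} {suc n} m F =
  trans (∑-comm {m} {k} _) (sum-cong-≗ (λ a → ∑-∑ʷ-comm m (λ i y → F i (a ∷ y))))

∑ʷ-comm : ∀ {m} (F : Word k n → Word k m → ℕ) → ∑ʷ[ x ] ∑ʷ (F x) ≡ ∑ʷ[ y ] ∑ʷ[ x ] F x y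
∑ʷ-comm {n = zero} F = refl
∑ʷ-comm {k} {suc n} F =
  trans (sum-cong-≗ (λ a → ∑ʷ-comm (λ y → F (a ∷ y)))) (∑-∑ʷ-comm k (λ a y → ∑ʷ[ x ] F (a ∷ x) y))

∑ʷ-δ : (x : Word k n) → ∑ʷ[ y ] 𝟙[ x ≟ʷ y ] ≡ 1
∑ʷ-δ [] = refl
∑ʷ-δ {k} {suc n} (a ∷ x) = begin
  ∑[ b < k ] ∑ʷ[ y ] 𝟙[ a ∷ x ≟ʷ b ∷ y ]
    ≡⟨ sum-cong-≗ (λ b → ∑ʷ-cong (λ y → split b y)) ⟩
  ∑[ b < k ] ∑ʷ[ y ] (𝟙[ a ≟ b ] * 𝟙[ x ≟ʷ y ])
    ≡⟨ sum-cong-≗ (λ b → *-distribˡ-∑ʷ 𝟙[ a ≟ b ] (λ y → 𝟙[ x ≟ʷ y ])) ⟨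
  ∑[ b < k ] (𝟙[ a ≟ b ] * ∑ʷ[ y ] 𝟙[ x ≟ʷ y ])
    ≡⟨ sum-cong-≗ (λ b → trans (cong (𝟙[ a ≟ b ] *_) (∑ʷ-δ x)) (*-identityʳ 𝟙[ a ≟ b ])) ⟩
  ∑[ b < k ] 𝟙[ a ≟ b ]
    ≡⟨ ∑-δ a ⟩
  1 ∎
  where
  split : ∀ b y → 𝟙[ a ∷ x ≟ʷ b ∷ y ] ≡ 𝟙[ a ≟ b ] * 𝟙[ x ≟ʷ y ]
  split b y = trans (𝟙-⇔ ∷-injective (λ (p , q) → cong₂ _∷_ p q) (a ∷ x ≟ʷ b ∷ y) (a ≟ b ×-dec x ≟ʷ y))
                    (𝟙-× (a ≟ b) (x ≟ʷ y))

∑ʷ-allWords : (F : Word k n → ℕ) → sum (map F (allWords k n)) ≡ ∑ʷ F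
∑ʷ-allWords {n = zero} F = +-identityʳ (F [])
∑ʷ-allWords {k} {suc n} F = begin
  sum (map F (allWords k (suc n)))
    ≡⟨ sum-map-concatMap F (λ a → map (a ∷_) (allWords k n)) (allFin k) ⟩
  sum (map (λ a → sum (map F (map (a ∷_) (allWords k n)))) (allFin k))
    ≡⟨ sum-map-allFin {k} (λ a → sum (map F (map (a ∷_) (allWords k n)))) ⟩
  ∑[ a < k ] sum (map F (map (a ∷_) (allWords k n)))
    ≡⟨ sum-cong-≗ (λ a → trans (cong sum (sym (map-∘ (allWords k n)))) (∑ʷ-allWords (λ y → F (a ∷ y)))) ⟩
  ∑[ a < k ] ∑ʷ (λ y → F (a ∷ y)) ∎

*-comm-2 : ∀ a b → a * (2 * b) ≡ 2 * a * b
*-comm-2 = solve-∀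

Close : ℕ → ℕ → Set
Close a b = a ≤ suc b × b ≤ suc a

Close-refl : ∀ a → Close a a
Close-refl a = n≤1+n a , n≤1+n a

Close-sym : ∀ {a b} → Close a b → Close b a
Close-sym (a≤1+b , b≤1+a) = b≤1+a , a≤1+b

Close-suc : ∀ {a b} → Close a b → Close (suc a) (suc b)
Close-suc (a≤1+b , b≤1+a) = s≤s a≤1+b , s≤s b≤1+a

Close-⊓ : ∀ {a a′ b b′} → Close a a′ → Close b b′ → Close (a ⊓ b) (a′ ⊓ b′)
Close-⊓ (a≤ , a′≤) (b≤ , b′≤) = ⊓-mono-≤ a≤ b≤ , ⊓-mono-≤ a′≤ b′≤

data CloseView : ℕ → ℕ → Set where
  equal : ∀ a → CloseView a a
  above : ∀ b → CloseView (suc b) b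
  below : ∀ a → CloseView a (suc a)

closeView : ∀ {a b} → Close a b → CloseView a b
closeView {zero} {zero} _ = equal 0
closeView {zero} {suc zero} _ = below 0
closeView {suc zero} {zero} _ = above 0
closeView {suc a} {suc b} (s≤s a≤1+b , s≤s b≤1+a) with closeView (a≤1+b , b≤1+a)
... | equal a = equal (suc a)
... | above b = above (suc b)
... | below a = below (suc a)
closeView {zero} {suc (suc b)} (_ , s≤s ())
closeView {suc (suc a)} {zero} (s≤s () , _)

Close-1+ : ∀ a → Close (suc a) a
Close-1+ a = ≤-refl , m≤n⇒m≤1+n (n≤1+n a)

Close-2*⊓ : ∀ {a b} → Close a b → Close (suc (2 * (a ⊓ b))) (2 * a)
Close-2*⊓ cl with closeView cl
... | equal a rewrite ⊓-idem a = Close-1+ (2 * a)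
... | above b rewrite m≥n⇒m⊓n≡n (n≤1+n b) | *-suc 2 b = Close-sym (Close-1+ (suc (2 * b)))
... | below a rewrite m≤n⇒m⊓n≡m (n≤1+n a) = Close-1+ (2 * a)

2*⊓+1-close : ∀ {a b} → Close a b → 2 * (a ⊓ b) + 1 ≡ a + b + 𝟙[ a ℕ.≟ b ]
2*⊓+1-close cl with closeView cl
... | equal a rewrite ⊓-idem a | 𝟙-yes (a ℕ.≟ a) refl = equal-case a
  where
  equal-case : ∀ a → 2 * a + 1 ≡ a + a + 1
  equal-case = solve-∀
... | above b rewrite m≥n⇒m⊓n≡n (n≤1+n b) | 𝟙-no (suc b ℕ.≟ b) (1+n≢n) = above-case b
  where
  above-case : ∀ b → 2 * b + 1 ≡ suc b + b + 0
  above-case = solve-∀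
... | below a rewrite m≤n⇒m⊓n≡m (n≤1+n a) | 𝟙-no (a ℕ.≟ suc a) (1+n≢n ∘ sym) = below-case a
  where
  below-case : ∀ a → 2 * a + 1 ≡ a + suc a + 0
  below-case = solve-∀

2*⊓+1-distinct : ∀ {a b} → Close a b → a ≢ b → 2 * (a ⊓ b) + 1 ≡ a + b
2*⊓+1-distinct {a} {b} cl a≢b =
  trans (2*⊓+1-close cl) (trans (cong (a + b +_) (𝟙-no (a ℕ.≟ b) a≢b)) (+-identityʳ (a + b)))

module _ {s t : Fin k} where

  act-source : (y : Word k n) → act s t (s ∷ y) ≡ t ∷ act s t y
  act-source y with s ≟ s
  ... | yes _ = refl
  ... | no s≢s = contradiction refl s≢s

  act-target : t ≢ s → (y : Word k n) → act s t (t ∷ y) ≡ s ∷ y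
  act-target t≢s y with t ≟ s
  ... | yes t≡s = contradiction t≡s t≢s
  ... | no _ with t ≟ t
  ...   | yes _ = refl
  ...   | no t≢t = contradiction refl t≢t

  act-other : ∀ {z} → z ≢ s → z ≢ t → (y : Word k n) → act s t (z ∷ y) ≡ z ∷ y
  act-other {z = z} z≢s z≢t y with z ≟ s
  ... | yes z≡s = contradiction z≡s z≢s
  ... | no _ with z ≟ t
  ...   | yes z≡t = contradiction z≡t z≢t
  ...   | no _ = refl

data Position (s t : Fin k) : Fin k → Set where
  at-source : Position s t s
  at-target : t ≢ s → Position s t t
  elsewhere : ∀ {a} → a ≢ s → a ≢ t → Position s t a

position : (s t a : Fin k) → Position s t a
position s t a with a ≟ s | a ≟ t
... | yes refl | _ = at-source
... | no a≢s | yes refl = at-target a≢s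
... | no a≢s | no a≢t = elsewhere a≢s a≢t

act-inverse : ∀ {s t : Fin k} → s ≢ t → (u : Word k n) → act t s (act s t u) ≡ u
act-inverse s≢t [] = refl
act-inverse {s = s} {t} s≢t (a ∷ u) with position s t a
... | at-source = begin
  act t s (act s t (s ∷ u)) ≡⟨ cong (act t s) (act-source {s = s} {t} u) ⟩
  act t s (t ∷ act s t u)   ≡⟨ act-source {s = t} {s} (act s t u) ⟩
  s ∷ act t s (act s t u)   ≡⟨ cong (s ∷_) (act-inverse s≢t u) ⟩
  s ∷ u                     ∎
... | at-target t≢s = trans (cong (act t s) (act-target t≢s u)) (act-target s≢t u)
... | elsewhere a≢s a≢t = trans (cong (act t s) (act-other a≢s a≢t u)) (act-other a≢t a≢s u)

module _ {V : Set} where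

  infixr 5 _++ᵂ_
  _++ᵂ_ : ∀ {R : V → V → Set} {u v w m m′} → Walk R u v m → Walk R v w m′ → Walk R u w (m + m′)
  here ++ᵂ q = q
  step e p ++ᵂ q = step e (p ++ᵂ q)

  Walk-cast : ∀ {R : V → V → Set} {u w m m′} → m ≡ m′ → Walk R u w m → Walk R u w m′
  Walk-cast refl p = p

  Walk-map : {R S : V → V → Set} → (∀ {u w} → R u w → S u w) → ∀ {u w m} → Walk R u w m → Walk S u w m
  Walk-map f here = here
  Walk-map f (step e p) = step (f e) (Walk-map f p)

  IsDistance-transfer : {R S : V → V → Set} {D : V → V → ℕ} →
    (∀ {u w} → R u w → S u w) → (∀ {u w} → S u w → R u w) → IsDistance R D → IsDistance S D
  IsDistance-transfer R⇒S S⇒R isDist u w =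
    Walk-map R⇒S (proj₁ (isDist u w)) , λ m p → proj₂ (isDist u w) m (Walk-map S⇒R p)

module Star {l : ℕ} (c : Fin (suc l)) where

  K : ℕ
  K = suc l

  g : Fin K → Word K n → Word K n
  g v = act v c

  dist : Word K n → Word K n → ℕ
  dist {n = zero} [] [] = 0
  dist {n = suc n} (a ∷ x) (b ∷ y) with a ≟ c | b ≟ c
  ... | yes _ | yes _ = 2 * dist x y
  ... | yes _ | no _ = suc (2 * (dist x y ⊓ dist x (g b y)))
  ... | no _ | yes _ = suc (2 * (dist x y ⊓ dist (g a x) y))
  ... | no _ | no _ with (a ≟ b) ×-dec (x ≟ʷ y)
  ...   | yes _ = 0
  ...   | no _ = 2 + 2 * ((dist x y ⊓ dist x (g b y)) ⊓ (dist (g a x) y ⊓ dist (g a x) (g b y)))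

  data HeadView : Fin K → Set where
    centre : HeadView c
    leaf : ∀ {v} → v ≢ c → HeadView v

  headView : ∀ a → HeadView a
  headView a with a ≟ c
  ... | yes refl = centre
  ... | no a≢c = leaf a≢c

  distToEdge : Word K n → Fin K → Word K n → ℕ
  distToEdge x v y = dist x y ⊓ dist x (g v y)

  distEdges : Fin K → Word K n → Fin K → Word K n → ℕ
  distEdges v x w y = distToEdge x w y ⊓ distToEdge (g v x) w y

  dist-cc : (x y : Word K n) → dist (c ∷ x) (c ∷ y) ≡ 2 * dist x y
  dist-cc x y with c ≟ c
  ... | yes _ = refl
  ... | no c≢c = contradiction refl c≢c

  dist-cℓ : ∀ {v} → v ≢ c → (x y : Word K n) → dist (c ∷ x) (v ∷ y) ≡ suc (2 * distToEdge x v y)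
  dist-cℓ {v = v} v≢c x y with c ≟ c | v ≟ c
  ... | yes _ | no _ = refl
  ... | no c≢c | _ = contradiction refl c≢c
  ... | _ | yes v≡c = contradiction v≡c v≢c

  dist-ℓc : ∀ {v} → v ≢ c → (x y : Word K n) → dist (v ∷ x) (c ∷ y) ≡ suc (2 * (dist x y ⊓ dist (g v x) y))
  dist-ℓc {v = v} v≢c x y with v ≟ c | c ≟ c
  ... | no _ | yes _ = refl
  ... | _ | no c≢c = contradiction refl c≢c
  ... | yes v≡c | _ = contradiction v≡c v≢c

  dist-ℓℓ-refl : ∀ {v} → v ≢ c → (x : Word K n) → dist (v ∷ x) (v ∷ x) ≡ 0
  dist-ℓℓ-refl {v = v} v≢c x with v ≟ c
  ... | yes v≡c = contradiction v≡c v≢c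
  ... | no _ with (v ≟ v) ×-dec (x ≟ʷ x)
  ...   | yes _ = refl
  ...   | no distinct = contradiction (refl , refl) distinct

  dist-ℓℓ : ∀ {v w} → v ≢ c → w ≢ c → (x y : Word K n) → ¬ (v ≡ w × x ≡ y) →
    dist (v ∷ x) (w ∷ y) ≡ 2 + 2 * distEdges v x w y
  dist-ℓℓ {v = v} {w} v≢c w≢c x y distinct with v ≟ c | w ≟ c
  ... | yes v≡c | _ = contradiction v≡c v≢c
  ... | no _ | yes w≡c = contradiction w≡c w≢c
  ... | no _ | no _ with (v ≟ w) ×-dec (x ≟ʷ y)
  ...   | yes same = contradiction same distinct
  ...   | no _ = refl

  dist-refl : (x : Word K n) → dist x x ≡ 0
  dist-refl [] = refl
  dist-refl (a ∷ x) with headView a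
  ... | centre = trans (dist-cc x x) (cong (2 *_) (dist-refl x))
  ... | leaf a≢c = dist-ℓℓ-refl a≢c x

  dist-sym : (x y : Word K n) → dist x y ≡ dist y x
  dist-sym [] [] = refl
  dist-sym (a ∷ x) (b ∷ y) with headView a | headView b
  ... | centre | centre = begin
    dist (c ∷ x) (c ∷ y) ≡⟨ dist-cc x y ⟩
    2 * dist x y         ≡⟨ cong (2 *_) (dist-sym x y) ⟩
    2 * dist y x         ≡⟨ dist-cc y x ⟨
    dist (c ∷ y) (c ∷ x) ∎
  ... | centre | leaf b≢c = begin
    dist (c ∷ x) (b ∷ y)                   ≡⟨ dist-cℓ b≢c x y ⟩
    suc (2 * (dist x y ⊓ dist x (g b y)))  ≡⟨ cong (λ m → suc (2 * m)) (cong₂ _⊓_ (dist-sym x y) (dist-sym x (g b y))) ⟩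
    suc (2 * (dist y x ⊓ dist (g b y) x))  ≡⟨ dist-ℓc b≢c y x ⟨
    dist (b ∷ y) (c ∷ x)                   ∎
  ... | leaf a≢c | centre = begin
    dist (a ∷ x) (c ∷ y)                   ≡⟨ dist-ℓc a≢c x y ⟩
    suc (2 * (dist x y ⊓ dist (g a x) y))  ≡⟨ cong (λ m → suc (2 * m)) (cong₂ _⊓_ (dist-sym x y) (dist-sym (g a x) y)) ⟩
    suc (2 * (dist y x ⊓ dist y (g a x)))  ≡⟨ dist-cℓ a≢c y x ⟨
    dist (c ∷ y) (a ∷ x)                   ∎
  ... | leaf a≢c | leaf b≢c with (a ≟ b) ×-dec (x ≟ʷ y)
  ...   | yes (refl , refl) = refl
  ...   | no distinct = begin
    dist (a ∷ x) (b ∷ y)       ≡⟨ dist-ℓℓ a≢c b≢c x y distinct ⟩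
    2 + 2 * distEdges a x b y  ≡⟨ cong (λ m → 2 + 2 * m) distEdges-sym ⟩
    2 + 2 * distEdges b y a x  ≡⟨ dist-ℓℓ b≢c a≢c y x (λ (p , q) → distinct (sym p , sym q)) ⟨
    dist (b ∷ y) (a ∷ x)       ∎
    where
    distEdges-sym : distEdges a x b y ≡ distEdges b y a x
    distEdges-sym = begin
      (dist x y ⊓ dist x (g b y)) ⊓ (dist (g a x) y ⊓ dist (g a x) (g b y))
        ≡⟨ ⊓-interchange (dist x y) _ _ _ ⟩
      (dist x y ⊓ dist (g a x) y) ⊓ (dist x (g b y) ⊓ dist (g a x) (g b y))
        ≡⟨ cong₂ _⊓_ (cong₂ _⊓_ (dist-sym x y) (dist-sym (g a x) y))
                     (cong₂ _⊓_ (dist-sym x (g b y)) (dist-sym (g a x) (g b y))) ⟩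
      (dist y x ⊓ dist y (g a x)) ⊓ (dist (g b y) x ⊓ dist (g b y) (g a x)) ∎

  module _ {v : Fin K} (v≢c : v ≢ c) where

    g-centre : (y : Word K n) → g v (c ∷ y) ≡ v ∷ y
    g-centre = act-target (v≢c ∘ sym)

    g-leaf : (y : Word K n) → g v (v ∷ y) ≡ c ∷ g v y
    g-leaf = act-source

    g-other : ∀ {a} → a ≢ c → a ≢ v → (y : Word K n) → g v (a ∷ y) ≡ a ∷ y
    g-other a≢c a≢v = act-other a≢v a≢c

  Lipschitz : ℕ → Set
  Lipschitz n = ∀ {v} → v ≢ c → (x y : Word K n) → Close (dist x y) (dist (g v x) y)

  close-along-star-edge : Lipschitz n → ∀ {v} → v ≢ c → (x : Word K n) (Y : Word K (suc n)) →
    Close (dist (c ∷ x) Y) (dist (v ∷ x) Y)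
  close-along-star-edge lip {v} v≢c x (b ∷ y) with headView b
  ... | centre rewrite dist-cc x y | dist-ℓc v≢c x y = Close-sym (Close-2*⊓ (lip v≢c x y))
  ... | leaf b≢c rewrite dist-cℓ b≢c x y with (v ≟ b) ×-dec (x ≟ʷ y)
  ...   | yes (refl , refl) rewrite dist-ℓℓ-refl v≢c x | dist-refl x = Close-1+ 0
  ...   | no distinct rewrite dist-ℓℓ v≢c b≢c x y distinct =
    Close-sym (Close-suc (Close-2*⊓ (Close-⊓ (lip v≢c x y) (lip v≢c x (g b y)))))

  close-along-lifted-edge : Lipschitz n → ∀ {v} → v ≢ c → (x : Word K n) (Y : Word K (suc n)) →
    Close (dist (v ∷ x) Y) (dist (c ∷ g v x) Y)
  close-along-lifted-edge lip {v} v≢c x (b ∷ y) with headView b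
  ... | centre rewrite dist-cc (g v x) y | dist-ℓc v≢c x y | ⊓-comm (dist x y) (dist (g v x) y) =
    Close-2*⊓ (Close-sym (lip v≢c x y))
  ... | leaf b≢c rewrite dist-cℓ b≢c (g v x) y with (v ≟ b) ×-dec (x ≟ʷ y)
  ...   | yes (refl , refl) rewrite dist-ℓℓ-refl v≢c x | dist-refl (g v x) | ⊓-zeroʳ (dist (g v x) x) =
    Close-sym (Close-1+ 0)
  ...   | no distinct rewrite dist-ℓℓ v≢c b≢c x y distinct
                            | ⊓-comm (distToEdge x b y) (distToEdge (g v x) b y) =
    Close-suc (Close-2*⊓ (Close-sym (Close-⊓ (lip v≢c x y) (lip v≢c x (g b y)))))

  dist-closeˡ : Lipschitz n
  dist-closeˡ v≢c [] [] = Close-refl 0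
  dist-closeˡ {v = v} v≢c (a ∷ x) Y with position v c a
  ... | at-source rewrite g-leaf v≢c x = close-along-lifted-edge dist-closeˡ v≢c x Y
  ... | at-target _ rewrite g-centre v≢c x = close-along-star-edge dist-closeˡ v≢c x Y
  ... | elsewhere a≢v a≢c rewrite g-other v≢c a≢c a≢v x = Close-refl _

  side : Word K n → ℕ
  side [] = 0
  side (a ∷ _) with headView a
  ... | centre = 0
  ... | leaf _ = 1

  private
    double+0 : ∀ m → 2 * m + 0 ≡ m * 2
    double+0 = solve-∀
    odd+1 : ∀ m → suc (2 * m) + 1 ≡ suc m * 2
    odd+1 = solve-∀
    even+2 : ∀ m → 2 + 2 * m + 2 ≡ (2 + m) * 2
    even+2 = solve-∀

  dist-parity : (x y : Word K n) → 2 ∣ dist x y + (side x + side y)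
  dist-parity [] [] = divides 0 refl
  dist-parity (a ∷ x) (b ∷ y) with headView a | headView b
  ... | centre | centre rewrite dist-cc x y = divides (dist x y) (double+0 (dist x y))
  ... | centre | leaf b≢c rewrite dist-cℓ b≢c x y = divides (suc (distToEdge x b y)) (odd+1 (distToEdge x b y))
  ... | leaf a≢c | centre rewrite dist-ℓc a≢c x y =
    divides (suc (dist x y ⊓ dist (g a x) y)) (odd+1 (dist x y ⊓ dist (g a x) y))
  ... | leaf a≢c | leaf b≢c with (a ≟ b) ×-dec (x ≟ʷ y)
  ...   | yes (refl , refl) rewrite dist-ℓℓ-refl a≢c x = divides 1 refl
  ...   | no distinct rewrite dist-ℓℓ a≢c b≢c x y distinct =
    divides (2 + distEdges a x b y) (even+2 (distEdges a x b y))

  moves : Fin K → Word K n → ℕ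
  moves v [] = 0
  moves v (a ∷ _) with position v c a
  ... | at-source = 1
  ... | at-target _ = 1
  ... | elsewhere _ _ = 0

  data Motion (v : Fin K) (y : Word K n) : Set where
    fixed : g v y ≡ y → moves v y ≡ 0 → Motion v y
    moving : moves v y ≡ 1 → side y + side (g v y) ≡ 1 → Motion v y

  side-centre : (y : Word K n) → side (c ∷ y) ≡ 0
  side-centre y with headView c
  ... | centre = refl
  ... | leaf c≢c = contradiction refl c≢c

  side-leaf : ∀ {v} → v ≢ c → (y : Word K n) → side (v ∷ y) ≡ 1
  side-leaf {v = v} v≢c y with headView v
  ... | centre = contradiction refl v≢c
  ... | leaf _ = refl

  module _ {v : Fin K} (v≢c : v ≢ c) where

    moves-centre : (y : Word K n) → moves v (c ∷ y) ≡ 1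
    moves-centre y with position v c c
    ... | at-source = refl
    ... | at-target _ = refl
    ... | elsewhere _ c≢c = contradiction refl c≢c

    moves-leaf : (y : Word K n) → moves v (v ∷ y) ≡ 1
    moves-leaf y with position v c v
    ... | at-source = refl
    ... | at-target _ = refl
    ... | elsewhere v≢v _ = contradiction refl v≢v

    moves-other : ∀ {a} → a ≢ c → a ≢ v → (y : Word K n) → moves v (a ∷ y) ≡ 0
    moves-other {a = a} a≢c a≢v y with position v c a
    ... | at-source = contradiction refl a≢v
    ... | at-target _ = contradiction refl a≢c
    ... | elsewhere _ _ = refl

    motion : (y : Word K n) → Motion v y
    motion [] = fixed refl refl
    motion (a ∷ y) with position v c a
    ... | at-source = moving (moves-leaf y)
      (cong₂ _+_ (side-leaf v≢c y) (trans (cong side (g-leaf v≢c y)) (side-centre (g v y))))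
    ... | at-target _ = moving (moves-centre y)
      (cong₂ _+_ (side-centre y) (trans (cong side (g-centre v≢c y)) (side-leaf v≢c y)))
    ... | elsewhere a≢v a≢c = fixed (g-other v≢c a≢c a≢v y) (moves-other a≢c a≢v y)

  dist-closeʳ : ∀ {v} → v ≢ c → (x y : Word K n) → Close (dist x y) (dist x (g v y))
  dist-closeʳ {v = v} v≢c x y rewrite dist-sym x y | dist-sym x (g v y) = dist-closeˡ v≢c y x

  dist-distinct : (x y y′ : Word K n) → side y + side y′ ≡ 1 → dist x y ≢ dist x y′
  dist-distinct x y y′ sides≡1 D≡D′ = 2≢1 (∣1⇒≡1 (∣m+n∣m⇒∣n 2∣2t+1 (m∣m*n (dist x y + side x))))
    where
    2≢1 : 2 ≢ 1
    2≢1 ()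
    regroup : ∀ d s t t′ → d + (s + t) + (d + (s + t′)) ≡ 2 * (d + s) + (t + t′)
    regroup = solve-∀
    2∣2t+1 : 2 ∣ 2 * (dist x y + side x) + 1
    2∣2t+1 = subst (2 ∣_)
      (trans (cong (λ d → dist x y + (side x + side y) + (d + (side x + side y′))) (sym D≡D′))
             (trans (regroup (dist x y) (side x) (side y) (side y′)) (cong (2 * (dist x y + side x) +_) sides≡1)))
      (∣m∣n⇒∣m+n (dist-parity x y) (dist-parity x y′))

  Adj : ∀ n → Word K n → Word K n → Set
  Adj n u w = Σ[ v ∈ Fin K ] (v ≢ c × (w ≡ g v u ⊎ u ≡ g v w))

  Adj-sym : ∀ {u w : Word K n} → Adj n u w → Adj n w u
  Adj-sym (v , v≢c , inj₁ w≡gu) = v , v≢c , inj₂ w≡gu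
  Adj-sym (v , v≢c , inj₂ u≡gw) = v , v≢c , inj₁ u≡gw

  star-edge : ∀ {v} → v ≢ c → (x : Word K n) → Adj (suc n) (c ∷ x) (v ∷ x)
  star-edge v≢c x = _ , v≢c , inj₁ (sym (g-centre v≢c x))

  lifted-edge : ∀ {v} → v ≢ c → (x : Word K n) → Adj (suc n) (v ∷ x) (c ∷ g v x)
  lifted-edge v≢c x = _ , v≢c , inj₁ (sym (g-leaf v≢c x))

  lift : ∀ {x y : Word K n} {m} → Walk (Adj n) x y m → Walk (Adj (suc n)) (c ∷ x) (c ∷ y) (2 * m)
  lift here = here
  lift {n} {x} {y} (step {v = x′} {m = m} (v , v≢c , edge) p) =
    subst (Walk (Adj (suc n)) (c ∷ x) (c ∷ y)) (sym (*-suc 2 m)) (lift-edge edge ++ᵂ lift p)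
    where
    lift-edge : x′ ≡ g v x ⊎ x ≡ g v x′ → Walk (Adj (suc n)) (c ∷ x) (c ∷ x′) 2
    lift-edge (inj₁ refl) = step (star-edge v≢c x) (step (lifted-edge v≢c x) here)
    lift-edge (inj₂ refl) = step (Adj-sym (lifted-edge v≢c x′)) (step (Adj-sym (star-edge v≢c x′)) here)

  nearest-hub : ∀ {a} → a ≢ c → (x : Word K n) (f : Word K n → ℕ) →
    Σ[ x′ ∈ Word K n ] (Adj (suc n) (a ∷ x) (c ∷ x′) × f x′ ≡ f x ⊓ f (g a x))
  nearest-hub a≢c x f with ⊓-sel (f x) (f (g _ x))
  ... | inj₁ min≡fx = x , Adj-sym (star-edge a≢c x) , sym min≡fx
  ... | inj₂ min≡fgx = g _ x , lifted-edge a≢c x , sym min≡fgx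

  path : (x y : Word K n) → Walk (Adj n) x y (dist x y)
  path-centre-to-leaf : ∀ {b} → b ≢ c → (x y : Word K n) →
    Walk (Adj (suc n)) (c ∷ x) (b ∷ y) (suc (2 * distToEdge x b y))

  path [] [] = here
  path (a ∷ x) (b ∷ y) with headView a | headView b
  ... | centre | centre = Walk-cast (sym (dist-cc x y)) (lift (path x y))
  ... | centre | leaf b≢c = Walk-cast (sym (dist-cℓ b≢c x y)) (path-centre-to-leaf b≢c x y)
  ... | leaf a≢c | centre with nearest-hub a≢c x (λ x′ → dist x′ y)
  ...   | x′ , a∷x─c∷x′ , d≡ = Walk-cast (trans (cong (λ m → suc (2 * m)) d≡) (sym (dist-ℓc a≢c x y)))
                                          (step a∷x─c∷x′ (lift (path x′ y)))
  path (a ∷ x) (b ∷ y) | leaf a≢c | leaf b≢c with (a ≟ b) ×-dec (x ≟ʷ y)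
  ...   | yes (refl , refl) = Walk-cast (sym (dist-ℓℓ-refl a≢c x)) here
  ...   | no distinct with nearest-hub a≢c x (λ x′ → distToEdge x′ b y)
  ...     | x′ , a∷x─c∷x′ , d≡ = Walk-cast (trans (cong (λ m → 2 + 2 * m) d≡) (sym (dist-ℓℓ a≢c b≢c x y distinct)))
                                            (step a∷x─c∷x′ (path-centre-to-leaf b≢c x′ y))

  path-centre-to-leaf b≢c x y with nearest-hub b≢c y (dist x)
  ... | y′ , b∷y─c∷y′ , d≡ = Walk-cast (trans (+-comm _ 1) (cong (λ m → suc (2 * m)) d≡))
                                        (lift (path x y′) ++ᵂ step (Adj-sym b∷y─c∷y′) here)

  dist-≤-walk : ∀ {u w : Word K n} {m} → Walk (Adj n) u w m → dist u w ≤ m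
  dist-≤-walk {u = u} here = ≤-reflexive (dist-refl u)
  dist-≤-walk {w = w} (step (v , v≢c , inj₁ refl) p) =
    ≤-trans (proj₁ (dist-closeˡ v≢c _ w)) (s≤s (dist-≤-walk p))
  dist-≤-walk {w = w} (step (v , v≢c , inj₂ refl) p) =
    ≤-trans (proj₂ (dist-closeˡ v≢c _ w)) (s≤s (dist-≤-walk p))

  dist-isDistance : ∀ n → IsDistance (Adj n) dist
  dist-isDistance n u w = path u w , λ m p → dist-≤-walk p

  -- Reversing the orientation of {c , v} replaces g v by its inverse act c v, so every orientation o
  -- gives the same graph.
  module _ (o : Fin K → Bool) where

    Schreier⇒Adj : ∀ {u w : Word K n} → SchreierAdj (StarEdge c o) n u w → Adj n u w
    Schreier⇒Adj (s , t , (v , v≢c , st≡) , moved) with o v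
    Schreier⇒Adj (_ , _ , (v , v≢c , refl) , inj₁ refl) | true = v , v≢c , inj₂ (sym (act-inverse (v≢c ∘ sym) _))
    Schreier⇒Adj (_ , _ , (v , v≢c , refl) , inj₂ refl) | true = v , v≢c , inj₁ (sym (act-inverse (v≢c ∘ sym) _))
    Schreier⇒Adj (_ , _ , (v , v≢c , refl) , inj₁ refl) | false = v , v≢c , inj₁ refl
    Schreier⇒Adj (_ , _ , (v , v≢c , refl) , inj₂ refl) | false = v , v≢c , inj₂ refl

    Adj⇒Schreier : ∀ {u w : Word K n} → Adj n u w → SchreierAdj (StarEdge c o) n u w
    Adj⇒Schreier {u = u} {w} (v , v≢c , moved) with o v in ov
    ... | true = c , v , (v , v≢c , cong (λ b → orient b c v) (sym ov)) , backwards moved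
      where
      backwards : w ≡ g v u ⊎ u ≡ g v w → act c v u ≡ w ⊎ act c v w ≡ u
      backwards (inj₁ w≡gu) = inj₂ (trans (cong (act c v) w≡gu) (act-inverse v≢c u))
      backwards (inj₂ u≡gw) = inj₁ (trans (cong (act c v) u≡gw) (act-inverse v≢c w))
    ... | false = v , c , (v , v≢c , cong (λ b → orient b c v) (sym ov)) , Sum.map sym sym moved

    dist-isDistance-Schreier : ∀ n → IsDistance (SchreierAdj (StarEdge c o) n) dist
    dist-isDistance-Schreier n = IsDistance-transfer Adj⇒Schreier Schreier⇒Adj (dist-isDistance n)

  ∑ᴸ : (Fin K → ℕ) → ℕ
  ∑ᴸ f = ∑[ j < l ] f (punchIn c j)

  infixl 10 ∑ᴸ
  syntax ∑ᴸ (λ v → e) = ∑ᴸ[ v ] e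

  ∑-centre+leaves : (f : Fin K → ℕ) → ∑ f ≡ f c + ∑ᴸ f
  ∑-centre+leaves f = sum-remove {i = c} f

  ∑-centre+leaf : ∀ {v} → v ≢ c → (f : Fin K → ℕ) → (∀ a → a ≢ c → a ≢ v → f a ≡ 0) → ∑ f ≡ f c + f v
  ∑-centre+leaf {v} v≢c f vanishes = trans (∑-centre+leaves f) (cong (f c +_) (begin
    ∑ᴸ f                            ≡⟨ ∑-single j (f ∘ punchIn c) vanishes′ ⟩
    f (punchIn c j)                 ≡⟨ cong f (punchIn-punchOut (v≢c ∘ sym)) ⟩
    f v                             ∎))
    where
    j = Fin.punchOut (v≢c ∘ sym)
    vanishes′ : ∀ i → i ≢ j → f (punchIn c i) ≡ 0
    vanishes′ i i≢j = vanishes _ (punchInᵢ≢i c i)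
      (λ eq → i≢j (punchIn-injective c i j (trans eq (sym (punchIn-punchOut (v≢c ∘ sym))))))

  ∑ᴸ-cong : {f h : Fin K → ℕ} → (∀ v → v ≢ c → f v ≡ h v) → ∑ᴸ f ≡ ∑ᴸ h
  ∑ᴸ-cong f≡h = sum-cong-≗ {l} (λ j → f≡h _ (punchInᵢ≢i c j))

  ∑ᴸ-const : ∀ m → ∑ᴸ[ v ] m ≡ l * m
  ∑ᴸ-const = ∑-const l

  ∑ᴸ-δ : ∀ {v} → v ≢ c → ∑ᴸ[ w ] 𝟙[ v ≟ w ] ≡ 1
  ∑ᴸ-δ {v} v≢c = +-cancelˡ-≡ 𝟙[ v ≟ c ] _ _ (begin
    𝟙[ v ≟ c ] + ∑ᴸ[ w ] 𝟙[ v ≟ w ] ≡⟨ ∑-centre+leaves (λ w → 𝟙[ v ≟ w ]) ⟨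
    ∑[ w < K ] 𝟙[ v ≟ w ]           ≡⟨ ∑-δ v ⟩
    1                               ≡⟨ cong (_+ 1) (𝟙-no (v ≟ c) v≢c) ⟨
    𝟙[ v ≟ c ] + 1                  ∎)

  -- The edges y ─ g v y of Γ(n), loops included, indexed by a leaf v and a word y.
  ∑ᴱ : (Fin K → Word K n → ℕ) → ℕ
  ∑ᴱ F = ∑ᴸ[ v ] ∑ʷ[ y ] F v y

  ∑ᴱ-syntax : ∀ n → (Fin K → Word K n → ℕ) → ℕ
  ∑ᴱ-syntax n = ∑ᴱ

  infixl 10 ∑ᴱ ∑ᴱ-syntax
  syntax ∑ᴱ (λ v y → e) = ∑ᴱ[ v , y ] e
  syntax ∑ᴱ-syntax n (λ v y → e) = ∑ᴱ[ v , y ∶ n ] e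

  ∑ᴱ-cong : {F G : Fin K → Word K n → ℕ} → (∀ v → v ≢ c → ∀ y → F v y ≡ G v y) → ∑ᴱ F ≡ ∑ᴱ G
  ∑ᴱ-cong F≡G = ∑ᴸ-cong (λ v v≢c → ∑ʷ-cong (F≡G v v≢c))

  ∑ᴱ-distrib-+ : (F G : Fin K → Word K n → ℕ) → ∑ᴱ[ v , y ] (F v y + G v y) ≡ ∑ᴱ F + ∑ᴱ G
  ∑ᴱ-distrib-+ F G = trans (sum-cong-≗ {l} (λ j → ∑ʷ-distrib-+ (F (punchIn c j)) (G (punchIn c j))))
                           (∑-distrib-+ (λ j → ∑ʷ (F (punchIn c j))) (λ j → ∑ʷ (G (punchIn c j))))

  *-distribˡ-∑ᴱ : ∀ m (F : Fin K → Word K n → ℕ) → m * ∑ᴱ F ≡ ∑ᴱ[ v , y ] (m * F v y)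
  *-distribˡ-∑ᴱ m F = trans (*-distribˡ-sum m (λ j → ∑ʷ (F (punchIn c j))))
                            (sum-cong-≗ {l} (λ j → *-distribˡ-∑ʷ m (F (punchIn c j))))

  ∑ᴱ-const : ∀ n m → ∑ᴱ {n} (λ _ _ → m) ≡ l * (K ^ n * m)
  ∑ᴱ-const n m = trans (sum-cong-≗ {l} (λ _ → ∑ʷ-const K n m)) (∑ᴸ-const (K ^ n * m))

  ∑-∑ᴱ-comm : ∀ m (F : Fin m → Fin K → Word K n → ℕ) → ∑[ i < m ] ∑ᴱ (F i) ≡ ∑ᴱ[ v , y ] ∑[ i < m ] F i v y
  ∑-∑ᴱ-comm m F = trans (∑-comm {m} {l} (λ i j → ∑ʷ (F i (punchIn c j))))
                        (sum-cong-≗ {l} (λ j → ∑-∑ʷ-comm m (λ i → F i (punchIn c j))))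

  ∑ʷ-∑ᴱ-comm : ∀ {m} (F : Word K m → Fin K → Word K n → ℕ) → ∑ʷ[ x ] ∑ᴱ (F x) ≡ ∑ᴱ[ v , y ] ∑ʷ[ x ] F x v y
  ∑ʷ-∑ᴱ-comm F = trans (sym (∑-∑ʷ-comm l (λ j x → ∑ʷ (F x (punchIn c j)))))
                       (sum-cong-≗ {l} (λ j → ∑ʷ-comm (λ x → F x (punchIn c j))))

  ∑ᴱ-suc : (F : Fin K → Word K (suc n) → ℕ) → ∑ᴱ F ≡ ∑ᴱ[ v , x ] ∑[ a < K ] F v (a ∷ x)
  ∑ᴱ-suc F = sum-cong-≗ {l} (λ j → ∑-∑ʷ-comm K (λ a x → F (punchIn c j) (a ∷ x)))

  ∑ᴱ²-distrib-+ : (F G : Fin K → Word K n → Fin K → Word K n → ℕ) →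
    ∑ᴱ[ v , x ] ∑ᴱ[ w , y ] (F v x w y + G v x w y) ≡ ∑ᴱ[ v , x ] ∑ᴱ (F v x) + ∑ᴱ[ v , x ] ∑ᴱ (G v x)
  ∑ᴱ²-distrib-+ F G = trans (∑ᴱ-cong (λ v _ x → ∑ᴱ-distrib-+ (F v x) (G v x)))
                            (∑ᴱ-distrib-+ (λ v x → ∑ᴱ (F v x)) (λ v x → ∑ᴱ (G v x)))

  *-distribˡ-∑ᴱ² : ∀ m (F : Fin K → Word K n → Fin K → Word K n → ℕ) →
    m * ∑ᴱ[ v , x ] ∑ᴱ (F v x) ≡ ∑ᴱ[ v , x ] ∑ᴱ[ w , y ] (m * F v x w y)
  *-distribˡ-∑ᴱ² m F =
    trans (*-distribˡ-∑ᴱ m (λ v x → ∑ᴱ (F v x))) (∑ᴱ-cong (λ v _ x → *-distribˡ-∑ᴱ m (F v x)))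

  ∑ʷ-suc : (F : Word K (suc n) → ℕ) → ∑ʷ F ≡ ∑ʷ[ x ] F (c ∷ x) + ∑ᴸ[ a ] ∑ʷ[ x ] F (a ∷ x)
  ∑ʷ-suc F = ∑-centre+leaves (λ a → ∑ʷ[ x ] F (a ∷ x))

  ∑ʷ-∘g : ∀ {v} → v ≢ c → (F : Word K n → ℕ) → ∑ʷ[ y ] F (g v y) ≡ ∑ʷ F
  ∑ʷ-∘g {n = zero} v≢c F = refl
  ∑ʷ-∘g {n = suc n} {v} v≢c F = begin
    ∑[ a < K ] ∑ʷ[ y ] F (g v (a ∷ y))    ≡⟨ sum-cong-≗ {K} swapped ⟩
    ∑[ a < K ] h (PC.transpose c v a)     ≡⟨ ∑-transpose c v h ⟨
    ∑[ a < K ] h a                        ∎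
    where
    h : Fin K → ℕ
    h a = ∑ʷ[ y ] F (a ∷ y)
    swapped : ∀ a → ∑ʷ[ y ] F (g v (a ∷ y)) ≡ h (PC.transpose c v a)
    swapped a with position v c a
    ... | at-source = begin
      ∑ʷ[ y ] F (g v (v ∷ y))  ≡⟨ ∑ʷ-cong (λ y → cong F (g-leaf v≢c y)) ⟩
      ∑ʷ[ y ] F (c ∷ g v y)    ≡⟨ ∑ʷ-∘g v≢c (λ y → F (c ∷ y)) ⟩
      h c                      ≡⟨ cong h (transpose-target (v≢c ∘ sym)) ⟨
      h (PC.transpose c v v)   ∎
    ... | at-target _ = trans (∑ʷ-cong (λ y → cong F (g-centre v≢c y))) (cong h (sym (transpose-source {i = c} {v})))
    ... | elsewhere a≢v a≢c =
      trans (∑ʷ-cong (λ y → cong F (g-other v≢c a≢c a≢v y))) (cong h (sym (transpose-other a≢c a≢v)))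

  ∑ᴱ-affine : ∀ a b (F : Fin K → Word K n → ℕ) → ∑ᴱ[ v , y ] (a + b * F v y) ≡ l * (K ^ n * a) + b * ∑ᴱ F
  ∑ᴱ-affine {n} a b F = trans (∑ᴱ-distrib-+ (λ _ _ → a) (λ v y → b * F v y))
                            (cong₂ _+_ (∑ᴱ-const n a) (sym (*-distribˡ-∑ᴱ b F)))

  ∑ʷ²-suc : (F : Word K (suc n) → Word K (suc n) → ℕ) →
    ∑ʷ[ X ] ∑ʷ (F X) ≡
      ∑ʷ[ x ∶ n ] (∑ʷ[ y ∶ n ] F (c ∷ x) (c ∷ y) + ∑ᴱ[ b , y ∶ n ] F (c ∷ x) (b ∷ y))
    + ∑ᴱ[ a , x ∶ n ] (∑ʷ[ y ∶ n ] F (a ∷ x) (c ∷ y) + ∑ᴱ[ b , y ∶ n ] F (a ∷ x) (b ∷ y))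
  ∑ʷ²-suc F = trans (∑ʷ-suc (λ X → ∑ʷ (F X)))
    (cong₂ _+_ (∑ʷ-cong (λ x → ∑ʷ-suc (F (c ∷ x)))) (∑ᴸ-cong (λ a _ → ∑ʷ-cong (λ x → ∑ʷ-suc (F (a ∷ x))))))

  ∑ʷ-+∘g : ∀ {v} → v ≢ c → (F : Word K n → ℕ) → ∑ʷ[ y ] (F y + F (g v y)) ≡ 2 * ∑ʷ F
  ∑ʷ-+∘g v≢c F = begin
    ∑ʷ[ y ] (F y + F (g _ y))     ≡⟨ ∑ʷ-distrib-+ F (F ∘ g _) ⟩
    ∑ʷ F + ∑ʷ[ y ] F (g _ y)      ≡⟨ cong (∑ʷ F +_) (∑ʷ-∘g v≢c F) ⟩
    ∑ʷ F + ∑ʷ F                   ≡⟨ cong (∑ʷ F +_) (+-identityʳ (∑ʷ F)) ⟨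
    2 * ∑ʷ F                      ∎

  tie : Fin K → Word K n → Fin K → Word K n → ℕ
  tie v x w y = moves v x * 𝟙[ distToEdge x w y ℕ.≟ distToEdge (g v x) w y ]

  tie-fixed : ∀ {v} {x : Word K n} w y → moves v x ≡ 0 → tie v x w y ≡ 0
  tie-fixed {v = v} {x} w y moves≡0 = cong (_* 𝟙[ distToEdge x w y ℕ.≟ distToEdge (g v x) w y ]) moves≡0

  tie-moving : ∀ {v} {x : Word K n} w y → moves v x ≡ 1 →
    tie v x w y ≡ 𝟙[ distToEdge x w y ℕ.≟ distToEdge (g v x) w y ]
  tie-moving {v = v} {x} w y moves≡1 =
    trans (cong (_* 𝟙[ distToEdge x w y ℕ.≟ distToEdge (g v x) w y ]) moves≡1) (*-identityˡ _)

  2*distToEdge+moves : ∀ {v} → v ≢ c → (x y : Word K n) →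
    2 * distToEdge x v y + moves v y ≡ dist x y + dist x (g v y)
  2*distToEdge+moves {v = v} v≢c x y with motion v≢c y
  ... | fixed gy≡y moves≡0 rewrite gy≡y | moves≡0 | ⊓-idem (dist x y) = twice (dist x y)
    where
    twice : ∀ d → 2 * d + 0 ≡ d + d
    twice = solve-∀
  ... | moving moves≡1 sides rewrite moves≡1 =
    2*⊓+1-distinct (dist-closeʳ v≢c x y) (dist-distinct x y (g v y) sides)

  2*distEdges+moves : ∀ {v} → v ≢ c → (x : Word K n) (w : Fin K) (y : Word K n) →
    2 * distEdges v x w y + moves v x ≡ distToEdge x w y + distToEdge (g v x) w y + tie v x w y
  2*distEdges+moves {v = v} v≢c x w y with motion v≢c x
  ... | fixed gx≡x moves≡0 = begin
    2 * (m ⊓ distToEdge (g v x) w y) + moves v x ≡⟨ cong₂ (λ z t → 2 * (m ⊓ distToEdge z w y) + t) gx≡x moves≡0 ⟩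
    2 * (m ⊓ m) + 0                             ≡⟨ cong (λ t → 2 * t + 0) (⊓-idem m) ⟩
    2 * m + 0                                   ≡⟨ twice m ⟩
    m + m + 0                                   ≡⟨ cong₂ (λ z t → m + distToEdge z w y + t) gx≡x
                                                         (tie-fixed {v = v} {x} w y moves≡0) ⟨
    m + distToEdge (g v x) w y + tie v x w y    ∎
    where
    m = distToEdge x w y
    twice : ∀ d → 2 * d + 0 ≡ d + d + 0
    twice = solve-∀
  ... | moving moves≡1 _ = begin
    2 * distEdges v x w y + moves v x ≡⟨ cong (2 * distEdges v x w y +_) moves≡1 ⟩
    2 * distEdges v x w y + 1         ≡⟨ 2*⊓+1-close (Close-⊓ (dist-closeˡ v≢c x y) (dist-closeˡ v≢c x (g w y))) ⟩
    m + m′ + 𝟙[ m ℕ.≟ m′ ]            ≡⟨ cong (m + m′ +_) (tie-moving {v = v} {x} w y moves≡1) ⟨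
    m + m′ + tie v x w y              ∎
    where
    m = distToEdge x w y
    m′ = distToEdge (g v x) w y

  sameEdge : Fin K → Word K n → Fin K → Word K n → ℕ
  sameEdge v x w y = 𝟙[ (v ≟ w) ×-dec (x ≟ʷ y) ]

  ∑ᴱ-sameEdge : ∀ {v} → v ≢ c → (x : Word K n) → ∑ᴱ (sameEdge v x) ≡ 1
  ∑ᴱ-sameEdge {v = v} v≢c x = begin
    ∑ᴸ[ w ] ∑ʷ[ y ] 𝟙[ (v ≟ w) ×-dec (x ≟ʷ y) ]
      ≡⟨ ∑ᴸ-cong (λ w _ → ∑ʷ-cong (λ y → 𝟙-× (v ≟ w) (x ≟ʷ y))) ⟩
    ∑ᴸ[ w ] ∑ʷ[ y ] (𝟙[ v ≟ w ] * 𝟙[ x ≟ʷ y ])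
      ≡⟨ ∑ᴸ-cong (λ w _ → *-distribˡ-∑ʷ 𝟙[ v ≟ w ] (λ y → 𝟙[ x ≟ʷ y ])) ⟨
    ∑ᴸ[ w ] (𝟙[ v ≟ w ] * ∑ʷ[ y ] 𝟙[ x ≟ʷ y ])
      ≡⟨ ∑ᴸ-cong (λ w _ → trans (cong (𝟙[ v ≟ w ] *_) (∑ʷ-δ x)) (*-identityʳ 𝟙[ v ≟ w ])) ⟩
    ∑ᴸ[ w ] 𝟙[ v ≟ w ]
      ≡⟨ ∑ᴸ-δ v≢c ⟩
    1 ∎

  dist-ℓℓ+2*sameEdge : ∀ {v w} → v ≢ c → w ≢ c → (x y : Word K n) →
    dist (v ∷ x) (w ∷ y) + 2 * sameEdge v x w y ≡ 2 + 2 * distEdges v x w y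
  dist-ℓℓ+2*sameEdge {v = v} {w} v≢c w≢c x y with (v ≟ w) ×-dec (x ≟ʷ y)
  ... | yes (refl , refl) rewrite dist-ℓℓ-refl v≢c x | dist-refl x = refl
  ... | no distinct rewrite dist-ℓℓ v≢c w≢c x y distinct = +-identityʳ _

  totalDist vertexEdgeDist edgeEdgeDist movingEdges ties : ℕ → ℕ
  totalDist n = ∑ʷ[ x ∶ n ] ∑ʷ[ y ] dist x y
  vertexEdgeDist n = ∑ʷ[ x ∶ n ] ∑ᴱ[ v , y ] distToEdge x v y
  edgeEdgeDist n = ∑ᴱ[ v , x ∶ n ] ∑ᴱ[ w , y ] distEdges v x w y
  movingEdges n = ∑ᴱ[ v , y ∶ n ] moves v y
  ties n = ∑ᴱ[ v , x ∶ n ] ∑ᴱ[ w , y ] tie v x w y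

  movingEdges-zero : movingEdges 0 ≡ 0
  movingEdges-zero = trans (∑ᴸ-const 0) (*-zeroʳ l)

  movingEdges-suc : ∀ n → movingEdges (suc n) ≡ l * (2 * K ^ n)
  movingEdges-suc n = trans (∑ᴸ-cong (λ v v≢c → per-leaf v≢c)) (∑ᴸ-const (2 * K ^ n))
    where
    ∑ʷ-zero : ∀ n → ∑ʷ {K} {n} (λ _ → 0) ≡ 0
    ∑ʷ-zero n = trans (∑ʷ-const K n 0) (*-zeroʳ (K ^ n))
    per-leaf : ∀ {v} → v ≢ c → ∑[ a < K ] ∑ʷ[ y ∶ n ] moves v (a ∷ y) ≡ 2 * K ^ n
    per-leaf {v} v≢c = begin
      ∑[ a < K ] ∑ʷ[ y ∶ n ] moves v (a ∷ y)
        ≡⟨ ∑-centre+leaf v≢c (λ a → ∑ʷ[ y ∶ n ] moves v (a ∷ y))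
             (λ a a≢c a≢v → trans (∑ʷ-cong (moves-other v≢c {n} a≢c a≢v)) (∑ʷ-zero n)) ⟩
      ∑ʷ[ y ∶ n ] moves v (c ∷ y) + ∑ʷ[ y ∶ n ] moves v (v ∷ y)
        ≡⟨ cong₂ _+_ (trans (∑ʷ-cong (moves-centre v≢c {n})) (∑ʷ-const K n 1))
                     (trans (∑ʷ-cong (moves-leaf v≢c {n})) (∑ʷ-const K n 1)) ⟩
      K ^ n * 1 + K ^ n * 1
        ≡⟨ cong₂ _+_ (*-identityʳ (K ^ n)) (*-identityʳ (K ^ n)) ⟩
      K ^ n + K ^ n
        ≡⟨ cong (K ^ n +_) (+-identityʳ (K ^ n)) ⟨
      2 * K ^ n ∎

  vertexEdgeDist-identity : ∀ n → 2 * vertexEdgeDist n + K ^ n * movingEdges n ≡ 2 * l * totalDist n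
  vertexEdgeDist-identity n = begin
    2 * ∑ʷ[ x ∶ n ] ∑ᴱ (distToEdge x) + K ^ n * movingEdges n
      ≡⟨ cong₂ _+_ (*-distribˡ-∑ʷ 2 (λ (x : Word K n) → ∑ᴱ (distToEdge x))) (sym (∑ʷ-const K n (movingEdges n))) ⟩
    ∑ʷ[ x ∶ n ] (2 * ∑ᴱ (distToEdge x)) + ∑ʷ[ x ∶ n ] movingEdges n
      ≡⟨ ∑ʷ-distrib-+ (λ (x : Word K n) → 2 * ∑ᴱ (distToEdge x)) (λ _ → movingEdges n) ⟨
    ∑ʷ[ x ∶ n ] (2 * ∑ᴱ (distToEdge x) + movingEdges n)
      ≡⟨ ∑ʷ-cong per-vertex ⟩
    ∑ʷ[ x ∶ n ] (2 * l * ∑ʷ (dist x))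
      ≡⟨ *-distribˡ-∑ʷ (2 * l) (λ (x : Word K n) → ∑ʷ (dist x)) ⟨
    2 * l * totalDist n ∎
    where
    per-vertex : (x : Word K n) → 2 * ∑ᴱ (distToEdge x) + movingEdges n ≡ 2 * l * ∑ʷ (dist x)
    per-vertex x = begin
      2 * ∑ᴱ (distToEdge x) + movingEdges n
        ≡⟨ cong (_+ movingEdges n) (*-distribˡ-∑ᴱ 2 (distToEdge x)) ⟩
      ∑ᴱ[ v , y ] (2 * distToEdge x v y) + movingEdges n
        ≡⟨ ∑ᴱ-distrib-+ (λ v y → 2 * distToEdge x v y) moves ⟨
      ∑ᴱ[ v , y ] (2 * distToEdge x v y + moves v y)
        ≡⟨ ∑ᴱ-cong (λ v v≢c y → 2*distToEdge+moves v≢c x y) ⟩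
      ∑ᴸ[ v ] ∑ʷ[ y ] (dist x y + dist x (g v y))
        ≡⟨ ∑ᴸ-cong (λ v v≢c → ∑ʷ-+∘g v≢c (dist x)) ⟩
      ∑ᴸ[ v ] (2 * ∑ʷ (dist x))
        ≡⟨ ∑ᴸ-const (2 * ∑ʷ (dist x)) ⟩
      l * (2 * ∑ʷ (dist x))
        ≡⟨ *-comm-2 l (∑ʷ (dist x)) ⟩
      2 * l * ∑ʷ (dist x) ∎

  edgeEdgeDist-identity : ∀ n → 2 * edgeEdgeDist n + l * K ^ n * movingEdges n ≡ 2 * l * vertexEdgeDist n + ties n
  edgeEdgeDist-identity n = begin
    2 * edgeEdgeDist n + l * K ^ n * movingEdges n
      ≡⟨ cong₂ _+_ (*-distribˡ-∑ᴱ 2 (λ v (x : Word K n) → ∑ᴱ (distEdges v x))) (*-distribˡ-∑ᴱ (l * K ^ n) (moves {n = n})) ⟩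
    ∑ᴱ[ v , x ∶ n ] (2 * ∑ᴱ (distEdges v x)) + ∑ᴱ[ v , x ∶ n ] (l * K ^ n * moves v x)
      ≡⟨ ∑ᴱ-distrib-+ (λ v (x : Word K n) → 2 * ∑ᴱ (distEdges v x)) (λ v (x : Word K n) → l * K ^ n * moves v x) ⟨
    ∑ᴱ[ v , x ∶ n ] (2 * ∑ᴱ (distEdges v x) + l * K ^ n * moves v x)
      ≡⟨ ∑ᴱ-cong per-edge ⟩
    ∑ᴱ[ v , x ∶ n ] (∑ᴱ (distToEdge x) + ∑ᴱ (distToEdge (g v x)) + ∑ᴱ (tie v x))
      ≡⟨ ∑ᴱ-distrib-+ (λ v (x : Word K n) → ∑ᴱ (distToEdge x) + ∑ᴱ (distToEdge (g v x))) (λ v (x : Word K n) → ∑ᴱ (tie v x)) ⟩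
    ∑ᴸ[ v ] ∑ʷ[ x ∶ n ] (∑ᴱ (distToEdge x) + ∑ᴱ (distToEdge (g v x))) + ties n
      ≡⟨ cong (_+ ties n) (∑ᴸ-cong (λ v v≢c → ∑ʷ-+∘g v≢c (λ (x : Word K n) → ∑ᴱ (distToEdge x)))) ⟩
    ∑ᴸ[ v ] (2 * vertexEdgeDist n) + ties n
      ≡⟨ cong (_+ ties n) (trans (∑ᴸ-const (2 * vertexEdgeDist n)) (*-comm-2 l (vertexEdgeDist n))) ⟩
    2 * l * vertexEdgeDist n + ties n ∎
    where
    per-edge : ∀ v → v ≢ c → (x : Word K n) →
      2 * ∑ᴱ (distEdges v x) + l * K ^ n * moves v x ≡ ∑ᴱ (distToEdge x) + ∑ᴱ (distToEdge (g v x)) + ∑ᴱ (tie v x)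
    per-edge v v≢c x = begin
      2 * ∑ᴱ (distEdges v x) + l * K ^ n * moves v x
        ≡⟨ cong₂ _+_ (*-distribˡ-∑ᴱ 2 (distEdges v x)) (trans (*-assoc l (K ^ n) (moves v x)) (sym (∑ᴱ-const n (moves v x)))) ⟩
      ∑ᴱ[ w , y ∶ n ] (2 * distEdges v x w y) + ∑ᴱ[ w , y ∶ n ] moves v x
        ≡⟨ ∑ᴱ-distrib-+ (λ w (y : Word K n) → 2 * distEdges v x w y) (λ _ _ → moves v x) ⟨
      ∑ᴱ[ w , y ∶ n ] (2 * distEdges v x w y + moves v x)
        ≡⟨ ∑ᴱ-cong (λ w _ y → 2*distEdges+moves v≢c x w y) ⟩
      ∑ᴱ[ w , y ∶ n ] (distToEdge x w y + distToEdge (g v x) w y + tie v x w y)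
        ≡⟨ ∑ᴱ-distrib-+ (λ w (y : Word K n) → distToEdge x w y + distToEdge (g v x) w y) (tie v x) ⟩
      ∑ᴱ[ w , y ∶ n ] (distToEdge x w y + distToEdge (g v x) w y) + ∑ᴱ (tie v x)
        ≡⟨ cong (_+ ∑ᴱ (tie v x)) (∑ᴱ-distrib-+ (distToEdge x) (distToEdge (g v x))) ⟩
      ∑ᴱ (distToEdge x) + ∑ᴱ (distToEdge (g v x)) + ∑ᴱ (tie v x) ∎

  ∑dist-from-centre : ∀ n → ∑ʷ[ x ∶ n ] (∑ʷ[ y ∶ n ] dist (c ∷ x) (c ∷ y) + ∑ᴱ[ b , y ∶ n ] dist (c ∷ x) (b ∷ y))
                    ≡ 2 * totalDist n + (K ^ n * (l * (K ^ n * 1)) + 2 * vertexEdgeDist n)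
  ∑dist-from-centre n = begin
    ∑ʷ[ x ∶ n ] (∑ʷ[ y ∶ n ] dist (c ∷ x) (c ∷ y) + ∑ᴱ[ b , y ∶ n ] dist (c ∷ x) (b ∷ y))
      ≡⟨ ∑ʷ-cong per-hub ⟩
    ∑ʷ[ x ∶ n ] (2 * ∑ʷ (dist x) + (l * (K ^ n * 1) + 2 * ∑ᴱ (distToEdge x)))
      ≡⟨ ∑ʷ-distrib-+ (λ (x : Word K n) → 2 * ∑ʷ (dist x)) (λ (x : Word K n) → l * (K ^ n * 1) + 2 * ∑ᴱ (distToEdge x)) ⟩
    ∑ʷ[ x ∶ n ] (2 * ∑ʷ (dist x)) + ∑ʷ[ x ∶ n ] (l * (K ^ n * 1) + 2 * ∑ᴱ (distToEdge x))
      ≡⟨ cong₂ _+_ (sym (*-distribˡ-∑ʷ 2 (λ (x : Word K n) → ∑ʷ (dist x))))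
                   (∑ʷ-affine (l * (K ^ n * 1)) 2 (λ (x : Word K n) → ∑ᴱ (distToEdge x))) ⟩
    2 * totalDist n + (K ^ n * (l * (K ^ n * 1)) + 2 * vertexEdgeDist n) ∎
    where
    per-hub : (x : Word K n) → ∑ʷ[ y ∶ n ] dist (c ∷ x) (c ∷ y) + ∑ᴱ[ b , y ∶ n ] dist (c ∷ x) (b ∷ y)
                               ≡ 2 * ∑ʷ (dist x) + (l * (K ^ n * 1) + 2 * ∑ᴱ (distToEdge x))
    per-hub x = cong₂ _+_ (trans (∑ʷ-cong (dist-cc x)) (sym (*-distribˡ-∑ʷ 2 (dist x))))
                          (trans (∑ᴱ-cong (λ b b≢c y → dist-cℓ b≢c x y)) (∑ᴱ-affine 1 2 (distToEdge x)))

  ∑dist-leaf-to-centre : ∀ n → ∑ᴱ[ a , x ∶ n ] ∑ʷ[ y ∶ n ] dist (a ∷ x) (c ∷ y)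
                         ≡ l * (K ^ n * (K ^ n * 1)) + 2 * vertexEdgeDist n
  ∑dist-leaf-to-centre n = begin
    ∑ᴱ[ a , x ∶ n ] ∑ʷ[ y ∶ n ] dist (a ∷ x) (c ∷ y)
      ≡⟨ ∑ᴱ-cong (λ a a≢c x → trans (∑ʷ-cong (λ y → trans (dist-ℓc a≢c x y) (cong (λ m → suc (2 * m)) (flip a x y))))
                                      (∑ʷ-affine 1 2 (λ (y : Word K n) → distToEdge y a x))) ⟩
    ∑ᴱ[ a , x ∶ n ] (K ^ n * 1 + 2 * ∑ʷ[ y ] distToEdge y a x)
      ≡⟨ ∑ᴱ-affine (K ^ n * 1) 2 (λ a (x : Word K n) → ∑ʷ[ y ] distToEdge y a x) ⟩
    l * (K ^ n * (K ^ n * 1)) + 2 * ∑ᴱ[ a , x ∶ n ] ∑ʷ[ y ] distToEdge y a x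
      ≡⟨ cong (λ m → l * (K ^ n * (K ^ n * 1)) + 2 * m) (∑ʷ-∑ᴱ-comm (distToEdge {n = n})) ⟨
    l * (K ^ n * (K ^ n * 1)) + 2 * vertexEdgeDist n ∎
    where
    flip : ∀ a (x y : Word K n) → dist x y ⊓ dist (g a x) y ≡ distToEdge y a x
    flip a x y = cong₂ _⊓_ (dist-sym x y) (dist-sym (g a x) y)

  ∑dist-leaf-to-leaf : ∀ n → ∑ᴱ[ a , x ∶ n ] ∑ᴱ[ b , y ∶ n ] dist (a ∷ x) (b ∷ y) + 2 * (l * (K ^ n * 1))
                          ≡ l * (K ^ n * (l * (K ^ n * 2))) + 2 * edgeEdgeDist n
  ∑dist-leaf-to-leaf n = begin
    ∑ᴱ[ a , x ∶ n ] ∑ᴱ[ b , y ∶ n ] dist (a ∷ x) (b ∷ y) + 2 * (l * (K ^ n * 1))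
      ≡⟨ cong (λ m → ∑ᴱ[ a , x ∶ n ] ∑ᴱ[ b , y ∶ n ] dist (a ∷ x) (b ∷ y) + 2 * m)
              (trans (sym (∑ᴱ-const n 1)) (∑ᴱ-cong (λ a a≢c (x : Word K n) → sym (∑ᴱ-sameEdge a≢c x)))) ⟩
    ∑ᴱ[ a , x ∶ n ] ∑ᴱ[ b , y ∶ n ] dist (a ∷ x) (b ∷ y) + 2 * ∑ᴱ[ a , x ∶ n ] ∑ᴱ (sameEdge a x)
      ≡⟨ cong (∑ᴱ[ a , x ∶ n ] ∑ᴱ[ b , y ∶ n ] dist (a ∷ x) (b ∷ y) +_)
              (*-distribˡ-∑ᴱ 2 (λ a (x : Word K n) → ∑ᴱ (sameEdge a x))) ⟩
    ∑ᴱ[ a , x ∶ n ] ∑ᴱ[ b , y ∶ n ] dist (a ∷ x) (b ∷ y) + ∑ᴱ[ a , x ∶ n ] (2 * ∑ᴱ (sameEdge a x))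
      ≡⟨ ∑ᴱ-distrib-+ (λ a (x : Word K n) → ∑ᴱ[ b , y ∶ n ] dist (a ∷ x) (b ∷ y)) (λ a (x : Word K n) → 2 * ∑ᴱ (sameEdge a x)) ⟨
    ∑ᴱ[ a , x ∶ n ] (∑ᴱ[ b , y ∶ n ] dist (a ∷ x) (b ∷ y) + 2 * ∑ᴱ (sameEdge a x))
      ≡⟨ ∑ᴱ-cong (λ a a≢c x → per-leaf a≢c x) ⟩
    ∑ᴱ[ a , x ∶ n ] (l * (K ^ n * 2) + 2 * ∑ᴱ (distEdges a x))
      ≡⟨ ∑ᴱ-affine (l * (K ^ n * 2)) 2 (λ a (x : Word K n) → ∑ᴱ (distEdges a x)) ⟩
    l * (K ^ n * (l * (K ^ n * 2))) + 2 * edgeEdgeDist n ∎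
    where
    per-leaf : ∀ {a} → a ≢ c → (x : Word K n) →
      ∑ᴱ[ b , y ∶ n ] dist (a ∷ x) (b ∷ y) + 2 * ∑ᴱ (sameEdge a x) ≡ l * (K ^ n * 2) + 2 * ∑ᴱ (distEdges a x)
    per-leaf {a} a≢c x = begin
      ∑ᴱ[ b , y ∶ n ] dist (a ∷ x) (b ∷ y) + 2 * ∑ᴱ (sameEdge a x)
        ≡⟨ cong (∑ᴱ[ b , y ∶ n ] dist (a ∷ x) (b ∷ y) +_) (*-distribˡ-∑ᴱ 2 (sameEdge a x)) ⟩
      ∑ᴱ[ b , y ∶ n ] dist (a ∷ x) (b ∷ y) + ∑ᴱ[ b , y ] (2 * sameEdge a x b y)
        ≡⟨ ∑ᴱ-distrib-+ (λ b (y : Word K n) → dist (a ∷ x) (b ∷ y)) (λ b (y : Word K n) → 2 * sameEdge a x b y) ⟨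
      ∑ᴱ[ b , y ] (dist (a ∷ x) (b ∷ y) + 2 * sameEdge a x b y)
        ≡⟨ ∑ᴱ-cong (λ b b≢c y → dist-ℓℓ+2*sameEdge a≢c b≢c x y) ⟩
      ∑ᴱ[ b , y ] (2 + 2 * distEdges a x b y)
        ≡⟨ ∑ᴱ-affine 2 2 (distEdges a x) ⟩
      l * (K ^ n * 2) + 2 * ∑ᴱ (distEdges a x) ∎

  totalDist-suc : ∀ n → totalDist (suc n) + 2 * (l * K ^ n) ≡
    2 * totalDist n + 4 * vertexEdgeDist n + 2 * edgeEdgeDist n + 2 * l * K ^ n * K ^ n + 2 * (l * K ^ n) * (l * K ^ n)
  totalDist-suc n = begin
    totalDist (suc n) + 2 * (l * K ^ n)
      ≡⟨ cong (_+ 2 * (l * K ^ n)) (trans (∑ʷ²-suc {n = n} dist) (cong (hubs +_) (∑ᴱ-distrib-+ leaf-hub leaf-leaf))) ⟩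
    hubs + (∑ᴱ leaf-hub + ∑ᴱ leaf-leaf) + 2 * (l * K ^ n)
      ≡⟨ regroup hubs (∑ᴱ leaf-hub) (∑ᴱ leaf-leaf) l (K ^ n) ⟩
    hubs + ∑ᴱ leaf-hub + (∑ᴱ leaf-leaf + 2 * (l * (K ^ n * 1)))
      ≡⟨ cong₂ _+_ (cong₂ _+_ (∑dist-from-centre n) (∑dist-leaf-to-centre n)) (∑dist-leaf-to-leaf n) ⟩
    2 * T + (N * (l * (N * 1)) + 2 * P) + (l * (N * (N * 1)) + 2 * P) + (l * (N * (l * (N * 2))) + 2 * Q)
      ≡⟨ collect T P Q l N ⟩
    2 * T + 4 * P + 2 * Q + 2 * l * N * N + 2 * (l * N) * (l * N) ∎
    where
    T = totalDist n
    P = vertexEdgeDist n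
    Q = edgeEdgeDist n
    N = K ^ n
    hubs = ∑ʷ[ x ∶ n ] (∑ʷ[ y ∶ n ] dist (c ∷ x) (c ∷ y) + ∑ᴱ[ b , y ∶ n ] dist (c ∷ x) (b ∷ y))
    leaf-hub leaf-leaf : Fin K → Word K n → ℕ
    leaf-hub a x = ∑ʷ[ y ∶ n ] dist (a ∷ x) (c ∷ y)
    leaf-leaf a x = ∑ᴱ[ b , y ∶ n ] dist (a ∷ x) (b ∷ y)
    regroup : ∀ h a b l m → h + (a + b) + 2 * (l * m) ≡ h + a + (b + 2 * (l * (m * 1)))
    regroup = solve-∀
    collect : ∀ t p q l m →
      2 * t + (m * (l * (m * 1)) + 2 * p) + (l * (m * (m * 1)) + 2 * p) + (l * (m * (l * (m * 2))) + 2 * q)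
      ≡ 2 * t + 4 * p + 2 * q + 2 * l * m * m + 2 * (l * m) * (l * m)
    collect = solve-∀

  2*wiener≡totalDist : ∀ n → 2 * wiener K n dist ≡ totalDist n
  2*wiener≡totalDist n = begin
    2 * pairSum dist (allWords K n)
      ≡⟨ pairSum-double dist dist-sym dist-refl (allWords K n) ⟩
    sum (map (λ x → sum (map (dist x) (allWords K n))) (allWords K n))
      ≡⟨ cong sum (map-cong (λ x → ∑ʷ-allWords (dist x)) (allWords K n)) ⟩
    sum (map (λ x → ∑ʷ (dist x)) (allWords K n))
      ≡⟨ ∑ʷ-allWords {n = n} (λ x → ∑ʷ (dist x)) ⟩
    totalDist n ∎

-- For leaves v, w and words x, y let A = dist x y, B = dist x (g w y), C = dist (g v x) y,
-- E = dist (g v x) (g w y) and d = dist (v ∷ x) (w ∷ y).  One level up, the edge (v , x) becomes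
-- c ∷ x ─ v ∷ x ─ c ∷ g v x and (w , y) becomes c ∷ y ─ w ∷ y ─ c ∷ g w y.  The distances from c ∷ x, v ∷ x
-- and c ∷ g v x to these two halves of (w , y) are hubToEdge and leafToEdge of A, B, C, E, d, and localTies
-- counts the ties among the four pairs of halves.

min4 : ℕ → ℕ → ℕ → ℕ → ℕ
min4 a b c e = (a ⊓ b) ⊓ (c ⊓ e)

hubToEdge : ℕ → ℕ → ℕ
hubToEdge a b = 2 * a ⊓ suc (2 * (a ⊓ b))

leafToEdge : ℕ → ℕ → ℕ → ℕ
leafToEdge d a b = d ⊓ suc (2 * (a ⊓ b))

localTies : ℕ → ℕ → ℕ → ℕ → ℕ → ℕ
localTies A B C E d =
  𝟙[ hubToEdge A B ℕ.≟ leafToEdge d A C ] + 𝟙[ hubToEdge B A ℕ.≟ leafToEdge d B E ] +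
  𝟙[ leafToEdge d A C ℕ.≟ hubToEdge C E ] + 𝟙[ leafToEdge d B E ℕ.≟ hubToEdge E C ]

module _ (p : ℕ) where

  ⊓-shift : ∀ a b → (p + a) ⊓ (p + b) ≡ p + (a ⊓ b)
  ⊓-shift a b = sym (+-distribˡ-⊓ p a b)

  min4-shift : ∀ a b c e → min4 (p + a) (p + b) (p + c) (p + e) ≡ p + min4 a b c e
  min4-shift a b c e = trans (cong₂ _⊓_ (⊓-shift a b) (⊓-shift c e)) (⊓-shift (a ⊓ b) (c ⊓ e))

  suc-2*⊓-shift : ∀ a b → suc (2 * ((p + a) ⊓ (p + b))) ≡ 2 * p + suc (2 * (a ⊓ b))
  suc-2*⊓-shift a b = begin
    suc (2 * ((p + a) ⊓ (p + b)))  ≡⟨ cong (λ m → suc (2 * m)) (⊓-shift a b) ⟩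
    suc (2 * (p + (a ⊓ b)))        ≡⟨ cong suc (*-distribˡ-+ 2 p (a ⊓ b)) ⟩
    suc (2 * p + 2 * (a ⊓ b))      ≡⟨ +-suc (2 * p) (2 * (a ⊓ b)) ⟨
    2 * p + suc (2 * (a ⊓ b))      ∎

  hubToEdge-shift : ∀ a b → hubToEdge (p + a) (p + b) ≡ 2 * p + hubToEdge a b
  hubToEdge-shift a b =
    trans (cong₂ _⊓_ (*-distribˡ-+ 2 p a) (suc-2*⊓-shift a b)) (sym (+-distribˡ-⊓ (2 * p) _ _))

  leafToEdge-shift : ∀ d a b → leafToEdge (2 * p + d) (p + a) (p + b) ≡ 2 * p + leafToEdge d a b
  leafToEdge-shift d a b = trans (cong ((2 * p + d) ⊓_) (suc-2*⊓-shift a b)) (sym (+-distribˡ-⊓ (2 * p) _ _))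

  localTies-shift : ∀ A B C E d → localTies (p + A) (p + B) (p + C) (p + E) (2 * p + d) ≡ localTies A B C E d
  localTies-shift A B C E d =
    cong₂ _+_ (cong₂ _+_ (cong₂ _+_ (𝟙-≟-shift (2 * p) (hubToEdge-shift A B) (leafToEdge-shift d A C))
                                    (𝟙-≟-shift (2 * p) (hubToEdge-shift B A) (leafToEdge-shift d B E)))
                         (𝟙-≟-shift (2 * p) (leafToEdge-shift d A C) (hubToEdge-shift C E)))
              (𝟙-≟-shift (2 * p) (leafToEdge-shift d B E) (hubToEdge-shift E C))

  Close-unshift : ∀ {a b} → Close (p + a) (p + b) → Close a b
  Close-unshift {a} {b} (a≤ , b≤) = +-cancelˡ-≤ p a (suc b) (subst (p + a ≤_) (sym (+-suc p b)) a≤)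
                                  , +-cancelˡ-≤ p b (suc a) (subst (p + b ≤_) (sym (+-suc p a)) b≤)

data Shifted : ℕ → ℕ → ℕ → ℕ → Set where
  shifted : ∀ p a b c e → min4 a b c e ≡ 0 → Shifted (p + a) (p + b) (p + c) (p + e)

shifted? : ∀ A B C E → Shifted A B C E
shifted? A B C E = subst₄ (m+[n∸m]≡n p≤A) (m+[n∸m]≡n p≤B) (m+[n∸m]≡n p≤C) (m+[n∸m]≡n p≤E)
                         (shifted p (A ∸ p) (B ∸ p) (C ∸ p) (E ∸ p) min≡0)
  where
  p = min4 A B C E
  p≤A : p ≤ A
  p≤A = ≤-trans (m⊓n≤m (A ⊓ B) (C ⊓ E)) (m⊓n≤m A B)
  p≤B : p ≤ B
  p≤B = ≤-trans (m⊓n≤m (A ⊓ B) (C ⊓ E)) (m⊓n≤n A B)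
  p≤C : p ≤ C
  p≤C = ≤-trans (m⊓n≤n (A ⊓ B) (C ⊓ E)) (m⊓n≤m C E)
  p≤E : p ≤ E
  p≤E = ≤-trans (m⊓n≤n (A ⊓ B) (C ⊓ E)) (m⊓n≤n C E)
  subst₄ : ∀ {a b c e A B C E} → a ≡ A → b ≡ B → c ≡ C → e ≡ E → Shifted a b c e → Shifted A B C E
  subst₄ refl refl refl refl s = s
  min≡0 : min4 (A ∸ p) (B ∸ p) (C ∸ p) (E ∸ p) ≡ 0
  min≡0 = +-cancelˡ-≡ p _ 0 (begin
    p + min4 (A ∸ p) (B ∸ p) (C ∸ p) (E ∸ p)    ≡⟨ min4-shift p _ _ _ _ ⟨
    min4 (p + (A ∸ p)) (p + (B ∸ p)) (p + (C ∸ p)) (p + (E ∸ p))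
      ≡⟨ cong₂ min4′ (cong₂ _,_ (m+[n∸m]≡n p≤A) (m+[n∸m]≡n p≤B)) (cong₂ _,_ (m+[n∸m]≡n p≤C) (m+[n∸m]≡n p≤E)) ⟩
    p                                           ≡⟨ +-identityʳ p ⟨
    p + 0                                       ∎)
    where
    min4′ : ℕ × ℕ → ℕ × ℕ → ℕ
    min4′ (a , b) (c , e) = min4 a b c e

Close⇒≤2+ : ∀ {a b} → Close a b → a ≤ 2 + b
Close⇒≤2+ (a≤1+b , _) = m≤n⇒m≤1+n a≤1+b

≤1+-trans : ∀ {a b c} → a ≤ suc b → b ≤ suc c → a ≤ 2 + c
≤1+-trans a≤1+b b≤1+c = ≤-trans a≤1+b (s≤s b≤1+c)

≤2-from-min4 : ∀ {x a b c e} → x ≤ 2 + a → x ≤ 2 + b → x ≤ 2 + c → x ≤ 2 + e → min4 a b c e ≡ 0 → x ≤ 2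
≤2-from-min4 {x} {a} {b} {c} {e} x≤a x≤b x≤c x≤e min≡0 =
  subst (x ≤_) (trans (min4-shift 2 a b c e) (cong (2 +_) min≡0)) (⊓-glb (⊓-glb x≤a x≤b) (⊓-glb x≤c x≤e))

Close? : ∀ a b → Dec (Close a b)
Close? a b = (a ℕ.≤? suc b) ×-dec (b ℕ.≤? suc a)

MovingTies FixedTies : ℕ → ℕ → ℕ → ℕ → Set
MovingTies A B C E = Close A B → Close C E → Close A C → Close B E → A ≢ C → B ≢ E →
  localTies A B C E (2 + 2 * min4 A B C E) ≡ 2 * 𝟙[ A ⊓ B ℕ.≟ C ⊓ E ]
FixedTies A B C E = Close A B → C ≡ A → E ≡ B → localTies A B C E (2 + 2 * min4 A B C E) ≡ 0

MovingTies? : ∀ A B C E → Dec (MovingTies A B C E)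
MovingTies? A B C E = Close? A B →-dec Close? C E →-dec Close? A C →-dec Close? B E →-dec
  ¬? (A ℕ.≟ C) →-dec ¬? (B ℕ.≟ E) →-dec (localTies A B C E (2 + 2 * min4 A B C E) ℕ.≟ 2 * 𝟙[ A ⊓ B ℕ.≟ C ⊓ E ])

FixedTies? : ∀ A B C E → Dec (FixedTies A B C E)
FixedTies? A B C E = Close? A B →-dec (C ℕ.≟ A) →-dec (E ℕ.≟ B) →-dec (localTies A B C E (2 + 2 * min4 A B C E) ℕ.≟ 0)

module _ {P : ℕ → ℕ → ℕ → ℕ → Set} (P? : ∀ a b c e → Dec (P a b c e)) where

  all-≤2? : Dec (∀ (i j i′ j′ : Fin 3) → P (toℕ i) (toℕ j) (toℕ i′) (toℕ j′))
  all-≤2? = all? λ i → all? λ j → all? λ i′ → all? λ j′ → P? (toℕ i) (toℕ j) (toℕ i′) (toℕ j′)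

  decide-≤2 : True all-≤2? → ∀ {a b c e} → a ≤ 2 → b ≤ 2 → c ≤ 2 → e ≤ 2 → P a b c e
  decide-≤2 checked a≤2 b≤2 c≤2 e≤2
    with fromℕ< (s≤s a≤2) | toℕ-fromℕ< (s≤s a≤2) | fromℕ< (s≤s b≤2) | toℕ-fromℕ< (s≤s b≤2)
       | fromℕ< (s≤s c≤2) | toℕ-fromℕ< (s≤s c≤2) | fromℕ< (s≤s e≤2) | toℕ-fromℕ< (s≤s e≤2)
  ... | i | refl | j | refl | i′ | refl | j′ | refl = toWitness {a? = all-≤2?} checked i j i′ j′

localTies-min4-shift : ∀ p a b c e →
  localTies (p + a) (p + b) (p + c) (p + e) (2 + 2 * min4 (p + a) (p + b) (p + c) (p + e))
  ≡ localTies a b c e (2 + 2 * min4 a b c e)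
localTies-min4-shift p a b c e = begin
  localTies (p + a) (p + b) (p + c) (p + e) (2 + 2 * min4 (p + a) (p + b) (p + c) (p + e))
    ≡⟨ cong (λ m → localTies (p + a) (p + b) (p + c) (p + e) (2 + 2 * m)) (min4-shift p a b c e) ⟩
  localTies (p + a) (p + b) (p + c) (p + e) (2 + 2 * (p + min4 a b c e))
    ≡⟨ cong (localTies (p + a) (p + b) (p + c) (p + e)) (rearrange p (min4 a b c e)) ⟩
  localTies (p + a) (p + b) (p + c) (p + e) (2 * p + (2 + 2 * min4 a b c e))
    ≡⟨ localTies-shift p a b c e _ ⟩
  localTies a b c e (2 + 2 * min4 a b c e) ∎
  where
  rearrange : ∀ p m → 2 + 2 * (p + m) ≡ 2 * p + (2 + 2 * m)
  rearrange = solve-∀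

n≤2+n : ∀ n → n ≤ 2 + n
n≤2+n n = m≤n+m n 2

-- After shifting by their minimum, the four distances are at most 2, where both claims are finite checks.

movingTies-min0 : ∀ {a b c e} → min4 a b c e ≡ 0 → MovingTies a b c e
movingTies-min0 {a} {b} {c} {e} min≡0 ab ce ac be = decide-≤2 MovingTies? _ a≤2 b≤2 c≤2 e≤2 ab ce ac be
  where
  a≤2 = ≤2-from-min4 (n≤2+n a) (Close⇒≤2+ ab) (Close⇒≤2+ ac) (≤1+-trans (proj₁ ab) (proj₁ be)) min≡0
  b≤2 = ≤2-from-min4 (Close⇒≤2+ (Close-sym ab)) (n≤2+n b) (≤1+-trans (proj₂ ab) (proj₁ ac)) (Close⇒≤2+ be) min≡0
  c≤2 = ≤2-from-min4 (Close⇒≤2+ (Close-sym ac)) (≤1+-trans (proj₂ ac) (proj₁ ab)) (n≤2+n c) (Close⇒≤2+ ce) min≡0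
  e≤2 = ≤2-from-min4 (≤1+-trans (proj₂ be) (proj₂ ab)) (Close⇒≤2+ (Close-sym be)) (Close⇒≤2+ (Close-sym ce))
                     (n≤2+n e) min≡0

fixedTies-min0 : ∀ {a b c e} → min4 a b c e ≡ 0 → FixedTies a b c e
fixedTies-min0 {a} {b} min≡0 ab refl refl = decide-≤2 FixedTies? _ a≤2 b≤2 a≤2 b≤2 ab refl refl
  where
  a≤2 = ≤2-from-min4 (n≤2+n a) (Close⇒≤2+ ab) (n≤2+n a) (Close⇒≤2+ ab) min≡0
  b≤2 = ≤2-from-min4 (Close⇒≤2+ (Close-sym ab)) (n≤2+n b) (Close⇒≤2+ (Close-sym ab)) (n≤2+n b) min≡0

movingTies : ∀ {A B C E} → MovingTies A B C E
movingTies {A} {B} {C} {E} with shifted? A B C E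
... | shifted p a b c e min≡0 = λ AB CE AC BE A≢C B≢E → begin
  localTies (p + a) (p + b) (p + c) (p + e) (2 + 2 * min4 (p + a) (p + b) (p + c) (p + e))
    ≡⟨ localTies-min4-shift p a b c e ⟩
  localTies a b c e (2 + 2 * min4 a b c e)
    ≡⟨ movingTies-min0 min≡0 (Close-unshift p AB) (Close-unshift p CE) (Close-unshift p AC) (Close-unshift p BE)
                             (A≢C ∘ cong (p +_)) (B≢E ∘ cong (p +_)) ⟩
  2 * 𝟙[ a ⊓ b ℕ.≟ c ⊓ e ]
    ≡⟨ cong (2 *_) (𝟙-≟-shift p (⊓-shift p a b) (⊓-shift p c e)) ⟨
  2 * 𝟙[ (p + a) ⊓ (p + b) ℕ.≟ (p + c) ⊓ (p + e) ] ∎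

fixedTies : ∀ {A B C E} → FixedTies A B C E
fixedTies {A} {B} {C} {E} with shifted? A B C E
... | shifted p a b c e min≡0 = λ AB C≡A E≡B →
  trans (localTies-min4-shift p a b c e)
        (fixedTies-min0 min≡0 (Close-unshift p AB) (+-cancelˡ-≡ p c a C≡A) (+-cancelˡ-≡ p e b E≡B))

module StarTies {l : ℕ} (c : Fin (suc l)) where

  open Star c

  tie-fixedʳ : ∀ {v w} → v ≢ c → (x y : Word K n) → g w y ≡ y → tie v x w y ≡ 0
  tie-fixedʳ {v = v} {w} v≢c x y gy≡y with motion v≢c x
  ... | fixed _ moves≡0 = tie-fixed {v = v} {x} w y moves≡0
  ... | moving moves≡1 sides = begin
    tie v x w y                                            ≡⟨ tie-moving w y moves≡1 ⟩
    𝟙[ distToEdge x w y ℕ.≟ distToEdge (g v x) w y ]       ≡⟨ 𝟙-≟-cong (loop x) (loop (g v x)) ⟩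
    𝟙[ dist x y ℕ.≟ dist (g v x) y ]                       ≡⟨ 𝟙-no (dist x y ℕ.≟ dist (g v x) y) distinct ⟩
    0 ∎
    where
    loop : ∀ z → distToEdge z w y ≡ dist z y
    loop z = trans (cong (λ y′ → dist z y ⊓ dist z y′) gy≡y) (⊓-idem (dist z y))
    distinct : dist x y ≢ dist (g v x) y
    distinct eq = dist-distinct y x (g v x) sides (trans (dist-sym y x) (trans eq (dist-sym (g v x) y)))

  module _ {w : Fin K} (w≢c : w ≢ c) (x y : Word K n) where

    distToEdge-cc : distToEdge (c ∷ x) w (c ∷ y) ≡ hubToEdge (dist x y) (dist x (g w y))
    distToEdge-cc = cong₂ _⊓_ (dist-cc x y) (trans (cong (dist (c ∷ x)) (g-centre w≢c y)) (dist-cℓ w≢c x y))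

    distToEdge-cℓ : distToEdge (c ∷ x) w (w ∷ y) ≡ hubToEdge (dist x (g w y)) (dist x y)
    distToEdge-cℓ = begin
      dist (c ∷ x) (w ∷ y) ⊓ dist (c ∷ x) (g w (w ∷ y))
        ≡⟨ cong₂ _⊓_ (dist-cℓ w≢c x y) (trans (cong (dist (c ∷ x)) (g-leaf w≢c y)) (dist-cc x (g w y))) ⟩
      suc (2 * (dist x y ⊓ dist x (g w y))) ⊓ (2 * dist x (g w y))
        ≡⟨ ⊓-comm _ _ ⟩
      2 * dist x (g w y) ⊓ suc (2 * (dist x y ⊓ dist x (g w y)))
        ≡⟨ cong (λ m → 2 * dist x (g w y) ⊓ suc (2 * m)) (⊓-comm (dist x y) _) ⟩
      hubToEdge (dist x (g w y)) (dist x y) ∎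

  module _ {v w : Fin K} (v≢c : v ≢ c) (w≢c : w ≢ c) (x y : Word K n) where

    distToEdge-ℓc : distToEdge (v ∷ x) w (c ∷ y)
                    ≡ leafToEdge (dist (v ∷ x) (w ∷ y)) (dist x y) (dist (g v x) y)
    distToEdge-ℓc = begin
      dist (v ∷ x) (c ∷ y) ⊓ dist (v ∷ x) (g w (c ∷ y))
        ≡⟨ cong₂ _⊓_ (dist-ℓc v≢c x y) (cong (dist (v ∷ x)) (g-centre w≢c y)) ⟩
      suc (2 * (dist x y ⊓ dist (g v x) y)) ⊓ dist (v ∷ x) (w ∷ y)
        ≡⟨ ⊓-comm _ _ ⟩
      leafToEdge (dist (v ∷ x) (w ∷ y)) (dist x y) (dist (g v x) y) ∎

    distToEdge-ℓℓ : distToEdge (v ∷ x) w (w ∷ y)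
                    ≡ leafToEdge (dist (v ∷ x) (w ∷ y)) (dist x (g w y)) (dist (g v x) (g w y))
    distToEdge-ℓℓ =
      cong (dist (v ∷ x) (w ∷ y) ⊓_) (trans (cong (dist (v ∷ x)) (g-leaf w≢c y)) (dist-ℓc v≢c x (g w y)))

    ∑∑-tie≡localTies : ∑[ a < K ] ∑[ b < K ] tie v (a ∷ x) w (b ∷ y)
             ≡ localTies (dist x y) (dist x (g w y)) (dist (g v x) y) (dist (g v x) (g w y)) (dist (v ∷ x) (w ∷ y))
    ∑∑-tie≡localTies = begin
      ∑[ a < K ] ∑[ b < K ] tie v (a ∷ x) w (b ∷ y)
        ≡⟨ ∑-centre+leaf v≢c (λ a → ∑[ b < K ] tie v (a ∷ x) w (b ∷ y))
             (λ a a≢c a≢v → ∑-zero (λ b → tie v (a ∷ x) w (b ∷ y))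
                                   (λ b → tie-fixed {v = v} {a ∷ x} w (b ∷ y) (moves-other v≢c a≢c a≢v x))) ⟩
      ∑[ b < K ] tie v (c ∷ x) w (b ∷ y) + ∑[ b < K ] tie v (v ∷ x) w (b ∷ y)
        ≡⟨ cong₂ _+_ (two-heads (c ∷ x)) (two-heads (v ∷ x)) ⟩
      (tie v (c ∷ x) w (c ∷ y) + tie v (c ∷ x) w (w ∷ y)) + (tie v (v ∷ x) w (c ∷ y) + tie v (v ∷ x) w (w ∷ y))
        ≡⟨ +-assoc (tie v (c ∷ x) w (c ∷ y) + tie v (c ∷ x) w (w ∷ y)) _ _ ⟨
      tie v (c ∷ x) w (c ∷ y) + tie v (c ∷ x) w (w ∷ y) + tie v (v ∷ x) w (c ∷ y) + tie v (v ∷ x) w (w ∷ y)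
        ≡⟨ cong₂ _+_ (cong₂ _+_ (cong₂ _+_ tie-cc tie-cw) tie-vc) tie-vw ⟩
      localTies (dist x y) (dist x (g w y)) (dist (g v x) y) (dist (g v x) (g w y)) (dist (v ∷ x) (w ∷ y)) ∎
      where
      two-heads : (X : Word K (suc n)) → ∑[ b < K ] tie v X w (b ∷ y) ≡ tie v X w (c ∷ y) + tie v X w (w ∷ y)
      two-heads X = ∑-centre+leaf w≢c (λ b → tie v X w (b ∷ y))
        (λ b b≢c b≢w → tie-fixedʳ v≢c X (b ∷ y) (g-other w≢c b≢c b≢w y))
      from-hub : ∀ Y → tie v (c ∷ x) w Y ≡ 𝟙[ distToEdge (c ∷ x) w Y ℕ.≟ distToEdge (v ∷ x) w Y ]
      from-hub Y = trans (tie-moving w Y (moves-centre v≢c x)) (𝟙-≟-cong refl (cong (λ z → distToEdge z w Y) (g-centre v≢c x)))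
      from-leaf : ∀ Y → tie v (v ∷ x) w Y ≡ 𝟙[ distToEdge (v ∷ x) w Y ℕ.≟ distToEdge (c ∷ g v x) w Y ]
      from-leaf Y = trans (tie-moving w Y (moves-leaf v≢c x)) (𝟙-≟-cong refl (cong (λ z → distToEdge z w Y) (g-leaf v≢c x)))
      tie-cc = trans (from-hub (c ∷ y)) (𝟙-≟-cong (distToEdge-cc w≢c x y) distToEdge-ℓc)
      tie-cw = trans (from-hub (w ∷ y)) (𝟙-≟-cong (distToEdge-cℓ w≢c x y) distToEdge-ℓℓ)
      tie-vc = trans (from-leaf (c ∷ y)) (𝟙-≟-cong distToEdge-ℓc (distToEdge-cc w≢c (g v x) y))
      tie-vw = trans (from-leaf (w ∷ y)) (𝟙-≟-cong distToEdge-ℓℓ (distToEdge-cℓ w≢c (g v x) y))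

  dist-moved : ∀ {v} → v ≢ c → (x : Word K n) → side x + side (g v x) ≡ 1 → dist x (g v x) ≡ 1
  dist-moved {v = v} v≢c x sides with dist-closeʳ v≢c x x | dist-distinct x x (g v x) sides
  ... | _ , d≤1 | d≢0 rewrite dist-refl x = at-most-one-nonzero d≤1 (d≢0 ∘ sym)
    where
    at-most-one-nonzero : ∀ {d} → d ≤ 1 → d ≢ 0 → d ≡ 1
    at-most-one-nonzero {zero} _ d≢0 = contradiction refl d≢0
    at-most-one-nonzero {suc zero} _ _ = refl
    at-most-one-nonzero {suc (suc _)} (s≤s ()) _

  sameEdge-refl : ∀ v (x : Word K n) → sameEdge v x v x ≡ 1
  sameEdge-refl v x = 𝟙-yes ((v ≟ v) ×-dec (x ≟ʷ x)) (refl , refl)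

  ties-same-edge : ∀ {v} → v ≢ c → (x : Word K n) →
    localTies (dist x x) (dist x (g v x)) (dist (g v x) x) (dist (g v x) (g v x)) (dist (v ∷ x) (v ∷ x))
      + 4 * (moves v x * sameEdge v x v x)
    ≡ 2 * tie v x v x + 4 * sameEdge v x v x
  ties-same-edge {v = v} v≢c x = begin
    localTies (dist x x) b (dist (g v x) x) (dist (g v x) (g v x)) (dist (v ∷ x) (v ∷ x)) + 4 * (moves v x * sameEdge v x v x)
      ≡⟨ cong₂ (λ (d₁ , d₂ , d₃ , d₄) s → localTies d₁ b d₂ d₃ d₄ + 4 * (moves v x * s))
               (cong₂ _,_ (dist-refl x) (cong₂ _,_ (dist-sym (g v x) x) (cong₂ _,_ (dist-refl (g v x)) (dist-ℓℓ-refl v≢c x))))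
               (sameEdge-refl v x) ⟩
    localTies 0 b b 0 0 + 4 * (moves v x * 1)
      ≡⟨ by-motion (motion v≢c x) ⟩
    2 * tie v x v x + 4
      ≡⟨ cong (λ s → 2 * tie v x v x + 4 * s) (sameEdge-refl v x) ⟨
    2 * tie v x v x + 4 * sameEdge v x v x ∎
    where
    b = dist x (g v x)
    by-motion : Motion v x → localTies 0 b b 0 0 + 4 * (moves v x * 1) ≡ 2 * tie v x v x + 4
    by-motion (fixed gx≡x moves≡0) = begin
      localTies 0 b b 0 0 + 4 * (moves v x * 1)   ≡⟨ cong₂ (λ d m → localTies 0 d d 0 0 + 4 * (m * 1))
                                                            (trans (cong (dist x) gx≡x) (dist-refl x)) moves≡0 ⟩
      4                                           ≡⟨ cong (λ τ → 2 * τ + 4) (tie-fixed {v = v} {x} v x moves≡0) ⟨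
      2 * tie v x v x + 4                         ∎
    by-motion (moving moves≡1 sides) = begin
      localTies 0 b b 0 0 + 4 * (moves v x * 1)   ≡⟨ cong₂ (λ d m → localTies 0 d d 0 0 + 4 * (m * 1)) b≡1 moves≡1 ⟩
      6                                           ≡⟨ cong (λ τ → 2 * τ + 4) tie≡1 ⟨
      2 * tie v x v x + 4                         ∎
      where
      b≡1 = dist-moved v≢c x sides
      tie≡1 : tie v x v x ≡ 1
      tie≡1 = begin
        tie v x v x
          ≡⟨ tie-moving {v = v} {x} v x moves≡1 ⟩
        𝟙[ dist x x ⊓ b ℕ.≟ dist (g v x) x ⊓ dist (g v x) (g v x) ]
          ≡⟨ 𝟙-≟-cong (cong₂ _⊓_ (dist-refl x) b≡1) (cong₂ _⊓_ (trans (dist-sym (g v x) x) b≡1) (dist-refl (g v x))) ⟩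
        𝟙[ 0 ℕ.≟ 0 ]
          ≡⟨⟩
        1 ∎

  ties-different-edges : ∀ {v w} → v ≢ c → w ≢ c → (x y : Word K n) →
    localTies (dist x y) (dist x (g w y)) (dist (g v x) y) (dist (g v x) (g w y)) (2 + 2 * distEdges v x w y)
    ≡ 2 * tie v x w y
  ties-different-edges {v = v} {w} v≢c w≢c x y with motion v≢c x
  ... | fixed gx≡x moves≡0 =
    trans (fixedTies (dist-closeʳ w≢c x y) (cong (λ z → dist z y) gx≡x) (cong (λ z → dist z (g w y)) gx≡x))
          (cong (2 *_) (sym (tie-fixed {v = v} {x} w y moves≡0)))
  ... | moving moves≡1 sides =
    trans (movingTies (dist-closeʳ w≢c x y) (dist-closeʳ w≢c (g v x) y) (dist-closeˡ v≢c x y) (dist-closeˡ v≢c x (g w y))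
                      (distinct y) (distinct (g w y)))
          (cong (2 *_) (sym (tie-moving {v = v} {x} w y moves≡1)))
    where
    distinct : ∀ z → dist x z ≢ dist (g v x) z
    distinct z eq = dist-distinct z x (g v x) sides (trans (dist-sym z x) (trans eq (dist-sym (g v x) z)))

  ties-by-cases : ∀ {v w} → v ≢ c → w ≢ c → (x y : Word K n) → Dec (v ≡ w × x ≡ y) →
    localTies (dist x y) (dist x (g w y)) (dist (g v x) y) (dist (g v x) (g w y)) (dist (v ∷ x) (w ∷ y))
      + 4 * (moves v x * sameEdge v x w y)
    ≡ 2 * tie v x w y + 4 * sameEdge v x w y
  ties-by-cases v≢c _ x _ (yes (refl , refl)) = ties-same-edge v≢c x
  ties-by-cases {v = v} {w} v≢c w≢c x y (no distinct) = begin
    localTies d₁ d₂ d₃ d₄ (dist (v ∷ x) (w ∷ y)) + 4 * (moves v x * sameEdge v x w y)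
      ≡⟨ cong₂ (λ d s → localTies d₁ d₂ d₃ d₄ d + 4 * (moves v x * s)) (dist-ℓℓ v≢c w≢c x y distinct) not-same ⟩
    localTies d₁ d₂ d₃ d₄ (2 + 2 * distEdges v x w y) + 4 * (moves v x * 0)
      ≡⟨ cong (λ t → localTies d₁ d₂ d₃ d₄ (2 + 2 * distEdges v x w y) + 4 * t) (*-zeroʳ (moves v x)) ⟩
    localTies d₁ d₂ d₃ d₄ (2 + 2 * distEdges v x w y) + 0
      ≡⟨ +-identityʳ _ ⟩
    localTies d₁ d₂ d₃ d₄ (2 + 2 * distEdges v x w y)
      ≡⟨ ties-different-edges v≢c w≢c x y ⟩
    2 * tie v x w y
      ≡⟨ +-identityʳ _ ⟨
    2 * tie v x w y + 4 * 0
      ≡⟨ cong (λ s → 2 * tie v x w y + 4 * s) not-same ⟨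
    2 * tie v x w y + 4 * sameEdge v x w y ∎
    where
    d₁ = dist x y
    d₂ = dist x (g w y)
    d₃ = dist (g v x) y
    d₄ = dist (g v x) (g w y)
    not-same : sameEdge v x w y ≡ 0
    not-same = 𝟙-no ((v ≟ w) ×-dec (x ≟ʷ y)) distinct

  local-ties : ∀ {v w} → v ≢ c → w ≢ c → (x y : Word K n) →
    ∑[ a < K ] ∑[ b < K ] tie v (a ∷ x) w (b ∷ y) + 4 * (moves v x * sameEdge v x w y)
    ≡ 2 * tie v x w y + 4 * sameEdge v x w y
  local-ties {v = v} {w} v≢c w≢c x y =
    trans (cong (_+ 4 * (moves v x * sameEdge v x w y)) (∑∑-tie≡localTies v≢c w≢c x y))
          (ties-by-cases v≢c w≢c x y ((v ≟ w) ×-dec (x ≟ʷ y)))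

  ties-suc : ∀ n → ties (suc n) + 4 * movingEdges n ≡ 2 * ties n + 4 * (l * (K ^ n * 1))
  ties-suc n = begin
    ties (suc n) + 4 * movingEdges n
      ≡⟨ cong₂ _+_ regroup moving-as-double-sum ⟩
    ∑ᴱ[ v , x ∶ n ] ∑ᴱ[ w , y ∶ n ] ∑∑tie v x w y + ∑ᴱ[ v , x ∶ n ] ∑ᴱ[ w , y ∶ n ] (4 * (moves v x * sameEdge v x w y))
      ≡⟨ ∑ᴱ²-distrib-+ {n = n} ∑∑tie (λ v x w y → 4 * (moves v x * sameEdge v x w y)) ⟨
    ∑ᴱ[ v , x ∶ n ] ∑ᴱ[ w , y ∶ n ] (∑∑tie v x w y + 4 * (moves v x * sameEdge v x w y))
      ≡⟨ ∑ᴱ-cong (λ v v≢c (x : Word K n) → ∑ᴱ-cong (λ w w≢c y → local-ties v≢c w≢c x y)) ⟩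
    ∑ᴱ[ v , x ∶ n ] ∑ᴱ[ w , y ∶ n ] (2 * tie v x w y + 4 * sameEdge v x w y)
      ≡⟨ ∑ᴱ²-distrib-+ {n = n} (λ v x w y → 2 * tie v x w y) (λ v x w y → 4 * sameEdge v x w y) ⟩
    ∑ᴱ[ v , x ∶ n ] ∑ᴱ[ w , y ∶ n ] (2 * tie v x w y) + ∑ᴱ[ v , x ∶ n ] ∑ᴱ[ w , y ∶ n ] (4 * sameEdge v x w y)
      ≡⟨ cong₂ _+_ (*-distribˡ-∑ᴱ² {n = n} 2 tie) (*-distribˡ-∑ᴱ² {n = n} 4 sameEdge) ⟨
    2 * ties n + 4 * ∑ᴱ[ v , x ∶ n ] ∑ᴱ (sameEdge v x)
      ≡⟨ cong (λ t → 2 * ties n + 4 * t) (trans (∑ᴱ-cong (λ v v≢c (x : Word K n) → ∑ᴱ-sameEdge v≢c x)) (∑ᴱ-const n 1)) ⟩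
    2 * ties n + 4 * (l * (K ^ n * 1)) ∎
    where
    ∑∑tie : Fin K → Word K n → Fin K → Word K n → ℕ
    ∑∑tie v x w y = ∑[ a < K ] ∑[ b < K ] tie v (a ∷ x) w (b ∷ y)
    regroup : ties (suc n) ≡ ∑ᴱ[ v , x ∶ n ] ∑ᴱ (∑∑tie v x)
    regroup = trans (∑ᴱ-suc {n = n} (λ v X → ∑ᴱ (tie v X))) (∑ᴱ-cong (λ v _ x →
      trans (sum-cong-≗ {K} (λ a → ∑ᴱ-suc {n = n} (tie v (a ∷ x))))
            (∑-∑ᴱ-comm K (λ a w y → ∑[ b < K ] tie v (a ∷ x) w (b ∷ y)))))
    moving-as-double-sum : 4 * movingEdges n ≡ ∑ᴱ[ v , x ∶ n ] ∑ᴱ[ w , y ∶ n ] (4 * (moves v x * sameEdge v x w y))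
    moving-as-double-sum = begin
      4 * movingEdges n
        ≡⟨ cong (4 *_) (∑ᴱ-cong (λ v v≢c (x : Word K n) →
             trans (sym (*-identityʳ (moves v x))) (cong (moves v x *_) (sym (∑ᴱ-sameEdge v≢c x))))) ⟩
      4 * ∑ᴱ[ v , x ∶ n ] (moves v x * ∑ᴱ (sameEdge v x))
        ≡⟨ cong (4 *_) (∑ᴱ-cong (λ v _ (x : Word K n) → *-distribˡ-∑ᴱ (moves v x) (sameEdge v x))) ⟩
      4 * ∑ᴱ[ v , x ∶ n ] ∑ᴱ[ w , y ∶ n ] (moves v x * sameEdge v x w y)
        ≡⟨ *-distribˡ-∑ᴱ² {n = n} 4 (λ v x w y → moves v x * sameEdge v x w y) ⟩
      ∑ᴱ[ v , x ∶ n ] ∑ᴱ[ w , y ∶ n ] (4 * (moves v x * sameEdge v x w y)) ∎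

  ties-zero : ties 0 ≡ 0
  ties-zero = trans (∑ᴸ-cong (λ _ _ → trans (∑ᴸ-const 0) (*-zeroʳ l))) (trans (∑ᴸ-const 0) (*-zeroʳ l))

  ties≡2*movingEdges : ∀ n → ties n ≡ 2 * movingEdges n
  ties≡2*movingEdges zero = trans ties-zero (cong (2 *_) (sym movingEdges-zero))
  ties≡2*movingEdges (suc n) = +-cancelʳ-≡ (4 * movingEdges n) _ _ (begin
    ties (suc n) + 4 * movingEdges n                 ≡⟨ ties-suc n ⟩
    2 * ties n + 4 * (l * (K ^ n * 1))               ≡⟨ cong (λ t → 2 * t + 4 * (l * (K ^ n * 1))) (ties≡2*movingEdges n) ⟩
    2 * (2 * movingEdges n) + 4 * (l * (K ^ n * 1))  ≡⟨ rearrange (movingEdges n) l (K ^ n) ⟩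
    2 * (l * (2 * K ^ n)) + 4 * movingEdges n        ≡⟨ cong (λ t → 2 * t + 4 * movingEdges n) (movingEdges-suc n) ⟨
    2 * movingEdges (suc n) + 4 * movingEdges n      ∎)
    where
    rearrange : ∀ m l N → 2 * (2 * m) + 4 * (l * (N * 1)) ≡ 2 * (l * (2 * N)) + 4 * m
    rearrange = solve-∀

  totalDist-recurrence : ∀ n →
    totalDist (suc n) + 2 * l * K ^ n + 2 * K * K ^ n * movingEdges n
    ≡ 2 * K * K * totalDist n + 2 * l * K * K ^ n * K ^ n + 2 * movingEdges n
  totalDist-recurrence n = +-cancelʳ-≡ (2 * l * P) _ _ (begin
    T′ + 2 * l * N + 2 * K * N * M + 2 * l * P
      ≡⟨ split-off T′ l N M P ⟩
    (T′ + 2 * (l * N)) + 2 * K * N * M + 2 * l * P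
      ≡⟨ cong (λ t → t + 2 * K * N * M + 2 * l * P) (totalDist-suc n) ⟩
    2 * T + 4 * P + 2 * Q + 2 * l * N * N + 2 * (l * N) * (l * N) + 2 * K * N * M + 2 * l * P
      ≡⟨ regroup T P Q l N M ⟩
    2 * T + 2 * l * N * N + 2 * (l * N) * (l * N) + (2 + l) * (2 * P + N * M) + (2 * Q + l * N * M)
      ≡⟨ cong₂ (λ s t → 2 * T + 2 * l * N * N + 2 * (l * N) * (l * N) + (2 + l) * s + t)
               (vertexEdgeDist-identity n)
               (trans (edgeEdgeDist-identity n) (cong (2 * l * P +_) (ties≡2*movingEdges n))) ⟩
    2 * T + 2 * l * N * N + 2 * (l * N) * (l * N) + (2 + l) * (2 * l * T) + (2 * l * P + 2 * M)
      ≡⟨ collect T P l N M ⟩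
    2 * K * K * T + 2 * l * K * N * N + 2 * M + 2 * l * P ∎)
    where
    T′ = totalDist (suc n)
    T = totalDist n
    P = vertexEdgeDist n
    Q = edgeEdgeDist n
    M = movingEdges n
    N = K ^ n
    split-off : ∀ t l N M P → t + 2 * l * N + 2 * suc l * N * M + 2 * l * P ≡ t + 2 * (l * N) + 2 * suc l * N * M + 2 * l * P
    split-off = solve-∀
    regroup : ∀ T P Q l N M →
      2 * T + 4 * P + 2 * Q + 2 * l * N * N + 2 * (l * N) * (l * N) + 2 * suc l * N * M + 2 * l * P
      ≡ 2 * T + 2 * l * N * N + 2 * (l * N) * (l * N) + (2 + l) * (2 * P + N * M) + (2 * Q + l * N * M)
    regroup = solve-∀
    collect : ∀ T P l N M →
      2 * T + 2 * l * N * N + 2 * (l * N) * (l * N) + (2 + l) * (2 * l * T) + (2 * l * P + 2 * M)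
      ≡ 2 * suc l * suc l * T + 2 * l * suc l * N * N + 2 * M + 2 * l * P
    collect = solve-∀

-- Opened only here: the prefix +_ of ℤ would make sections such as (m +_) above ambiguous.
open import Data.Integer as ℤ using (ℤ; +_)
import Data.Integer.Properties as ℤ
import Data.Integer.Tactic.RingSolver as ℤ-Solver
open import Data.Rational as ℚ using (ℚ; _/_; toℚᵘ)
open import Data.Rational.Properties as ℚ using (toℚᵘ-injective; toℚᵘ-fromℚᵘ; toℚᵘ-homo-*; toℚᵘ-homo-+; toℚᵘ-homo‿-)
open import Data.Rational.Solver using () renaming (module +-*-Solver to ℚ-Solver)

pos-^ : ∀ m n → + (m ^ n) ≡ (+ m) ℤ.^ n
pos-^ m zero = refl
pos-^ m (suc n) = trans (ℤ.pos-* m (m ^ n)) (cong (+ m ℤ.*_) (pos-^ m n))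

pos-*³ : ∀ a b c → + (a * b * c) ≡ + a ℤ.* + b ℤ.* + c
pos-*³ a b c = trans (ℤ.pos-* (a * b) c) (cong (ℤ._* + c) (ℤ.pos-* a b))

pos-*⁴ : ∀ a b c d → + (a * b * c * d) ≡ + a ℤ.* + b ℤ.* + c ℤ.* + d
pos-*⁴ a b c d = trans (ℤ.pos-* (a * b * c) d) (cong (ℤ._* + d) (pos-*³ a b c))

pos-*⁵ : ∀ a b c d e → + (a * b * c * d * e) ≡ + a ℤ.* + b ℤ.* + c ℤ.* + d ℤ.* + e
pos-*⁵ a b c d e = trans (ℤ.pos-* (a * b * c * d) e) (cong (ℤ._* + e) (pos-*⁴ a b c d))

-- The ring solvers do not read _^_, so powers are unfolded in the identities they prove.

k³t≡k²·kt : ∀ k t → k ^ 3 * t ≡ k ^ 2 * (k * t)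
k³t≡k²·kt = expanded
  where
  expanded : ∀ k t → k * (k * (k * 1)) * t ≡ k * (k * 1) * (k * t)
  expanded = solve-∀

k³t≡k²t·k : ∀ k t → k ^ 3 * t ≡ k ^ 2 * t * k
k³t≡k²t·k = expanded
  where
  expanded : ∀ k t → k * (k * (k * 1)) * t ≡ k * (k * 1) * t * k
  expanded = solve-∀

module ClosedForm {l : ℕ} (c : Fin (suc l)) where

  open Star c
  open StarTies c

  κ : ℤ
  κ = + K

  totalDist-recurrence-ℤ : ∀ n →
    + totalDist (suc n) ≡
      + 2 ℤ.* κ ℤ.* κ ℤ.* + totalDist n ℤ.+ + 2 ℤ.* + l ℤ.* κ ℤ.* κ ℤ.^ n ℤ.* κ ℤ.^ n ℤ.+ + 2 ℤ.* + movingEdges n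
      ℤ.- + 2 ℤ.* + l ℤ.* κ ℤ.^ n ℤ.- + 2 ℤ.* κ ℤ.* κ ℤ.^ n ℤ.* + movingEdges n
  totalDist-recurrence-ℤ n = begin
    + T′
      ≡⟨ add-subtract (+ T′) (+ (2 * l * N)) (+ (2 * K * N * M)) ⟩
    + (T′ + 2 * l * N + 2 * K * N * M) ℤ.- + (2 * l * N) ℤ.- + (2 * K * N * M)
      ≡⟨ cong (λ z → + z ℤ.- + (2 * l * N) ℤ.- + (2 * K * N * M)) (totalDist-recurrence n) ⟩
    + (2 * K * K * T) ℤ.+ + (2 * l * K * N * N) ℤ.+ + (2 * M) ℤ.- + (2 * l * N) ℤ.- + (2 * K * N * M)
      ≡⟨ cong₂ ℤ._-_ (cong₂ ℤ._-_ (cong₂ ℤ._+_ (cong₂ ℤ._+_ (pos-*⁴ 2 K K T) (pos-*⁵ 2 l K N N)) (ℤ.pos-* 2 M))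
                                   (pos-*³ 2 l N))
                     (pos-*⁴ 2 K N M) ⟩
    + 2 ℤ.* κ ℤ.* κ ℤ.* + T ℤ.+ + 2 ℤ.* + l ℤ.* κ ℤ.* + N ℤ.* + N ℤ.+ + 2 ℤ.* + M
      ℤ.- + 2 ℤ.* + l ℤ.* + N ℤ.- + 2 ℤ.* κ ℤ.* + N ℤ.* + M
      ≡⟨ cong (λ ν → + 2 ℤ.* κ ℤ.* κ ℤ.* + T ℤ.+ + 2 ℤ.* + l ℤ.* κ ℤ.* ν ℤ.* ν ℤ.+ + 2 ℤ.* + M
                      ℤ.- + 2 ℤ.* + l ℤ.* ν ℤ.- + 2 ℤ.* κ ℤ.* ν ℤ.* + M) (pos-^ K n) ⟩
    + 2 ℤ.* κ ℤ.* κ ℤ.* + T ℤ.+ + 2 ℤ.* + l ℤ.* κ ℤ.* κ ℤ.^ n ℤ.* κ ℤ.^ n ℤ.+ + 2 ℤ.* + M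
      ℤ.- + 2 ℤ.* + l ℤ.* κ ℤ.^ n ℤ.- + 2 ℤ.* κ ℤ.* κ ℤ.^ n ℤ.* + M ∎
    where
    T′ = totalDist (suc n)
    T = totalDist n
    M = movingEdges n
    N = K ^ n
    add-subtract : ∀ x b c → x ≡ x ℤ.+ b ℤ.+ c ℤ.- b ℤ.- c
    add-subtract = ℤ-Solver.solve-∀

  t : ℕ
  t = 2 * K ∸ 1

  a₁ a₂ denominator : ℤ
  a₁ = (κ ℤ.- + 1) ℤ.^ 2 ℤ.* (+ 2 ℤ.* κ ℤ.^ 2 ℤ.- + 2 ℤ.* κ ℤ.- + 1)
  a₂ = (κ ℤ.- + 1) ℤ.* (κ ℤ.- + 2)
  denominator = κ ℤ.* κ ℤ.* κ ℤ.* (+ 2 ℤ.* κ ℤ.- + 1)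

  -- K³ (2K - 1) times the right-hand side of the theorem
  closedForm : ℕ → ℤ
  closedForm n = a₁ ℤ.* ((+ 2) ℤ.^ n ℤ.* κ ℤ.^ n ℤ.* κ ℤ.^ n) ℤ.- a₂ ℤ.* (κ ℤ.* (+ 2 ℤ.* κ ℤ.- + 1)) ℤ.* (κ ℤ.^ n ℤ.* κ ℤ.^ n)
                 ℤ.+ a₂ ℤ.* κ ℤ.* κ ℤ.^ n

  l≡κ-1 : + l ≡ κ ℤ.- + 1
  l≡κ-1 = shift (+ l)
    where
    shift : ∀ L → L ≡ (+ 1 ℤ.+ L) ℤ.- + 1
    shift = ℤ-Solver.solve-∀

  movingEdges-suc-ℤ : ∀ m → + movingEdges (suc m) ≡ (κ ℤ.- + 1) ℤ.* (+ 2 ℤ.* κ ℤ.^ m)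
  movingEdges-suc-ℤ m = begin
    + movingEdges (suc m)        ≡⟨ cong +_ (movingEdges-suc m) ⟩
    + (l * (2 * K ^ m))          ≡⟨ trans (ℤ.pos-* l (2 * K ^ m)) (cong (+ l ℤ.*_) (ℤ.pos-* 2 (K ^ m))) ⟩
    + l ℤ.* (+ 2 ℤ.* + (K ^ m))   ≡⟨ cong₂ (λ a b → a ℤ.* (+ 2 ℤ.* b)) l≡κ-1 (pos-^ K m) ⟩
    (κ ℤ.- + 1) ℤ.* (+ 2 ℤ.* κ ℤ.^ m) ∎

  closed-form : ∀ m → denominator ℤ.* + totalDist (suc m) ≡ + 2 ℤ.* closedForm (suc m)
  closed-form zero = begin
    denominator ℤ.* + totalDist 1
      ≡⟨ cong (denominator ℤ.*_) (trans (totalDist-recurrence-ℤ 0)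
           (cong₂ (λ L M → + 2 ℤ.* κ ℤ.* κ ℤ.* + 0 ℤ.+ + 2 ℤ.* L ℤ.* κ ℤ.* ℤ.1ℤ ℤ.* ℤ.1ℤ ℤ.+ + 2 ℤ.* M
                           ℤ.- + 2 ℤ.* L ℤ.* ℤ.1ℤ ℤ.- + 2 ℤ.* κ ℤ.* ℤ.1ℤ ℤ.* M) l≡κ-1 (cong +_ movingEdges-zero))) ⟩
    denominator ℤ.* (+ 2 ℤ.* κ ℤ.* κ ℤ.* + 0 ℤ.+ + 2 ℤ.* (κ ℤ.- + 1) ℤ.* κ ℤ.* ℤ.1ℤ ℤ.* ℤ.1ℤ ℤ.+ + 2 ℤ.* + 0
                     ℤ.- + 2 ℤ.* (κ ℤ.- + 1) ℤ.* ℤ.1ℤ ℤ.- + 2 ℤ.* κ ℤ.* ℤ.1ℤ ℤ.* + 0)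
      ≡⟨ base κ ⟩
    + 2 ℤ.* closedForm 1 ∎
    where
    base : ∀ k → k ℤ.* k ℤ.* k ℤ.* (+ 2 ℤ.* k ℤ.- + 1) ℤ.*
                 (+ 2 ℤ.* k ℤ.* k ℤ.* + 0 ℤ.+ + 2 ℤ.* (k ℤ.- + 1) ℤ.* k ℤ.* + 1 ℤ.* + 1 ℤ.+ + 2 ℤ.* + 0
                  ℤ.- + 2 ℤ.* (k ℤ.- + 1) ℤ.* + 1 ℤ.- + 2 ℤ.* k ℤ.* + 1 ℤ.* + 0)
      ≡ + 2 ℤ.* ((k ℤ.- + 1) ℤ.* ((k ℤ.- + 1) ℤ.* + 1) ℤ.* (+ 2 ℤ.* (k ℤ.* (k ℤ.* + 1)) ℤ.- + 2 ℤ.* k ℤ.- + 1)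
                   ℤ.* (+ 2 ℤ.* + 1 ℤ.* (k ℤ.* + 1) ℤ.* (k ℤ.* + 1))
                 ℤ.- (k ℤ.- + 1) ℤ.* (k ℤ.- + 2) ℤ.* (k ℤ.* (+ 2 ℤ.* k ℤ.- + 1)) ℤ.* ((k ℤ.* + 1) ℤ.* (k ℤ.* + 1))
                 ℤ.+ (k ℤ.- + 1) ℤ.* (k ℤ.- + 2) ℤ.* k ℤ.* (k ℤ.* + 1))
    base = ℤ-Solver.solve-∀
  closed-form (suc m) = begin
    denominator ℤ.* + totalDist (suc (suc m))
      ≡⟨ cong (denominator ℤ.*_) (trans (totalDist-recurrence-ℤ (suc m))
           (cong₂ (λ L M → + 2 ℤ.* κ ℤ.* κ ℤ.* T ℤ.+ + 2 ℤ.* L ℤ.* κ ℤ.* (κ ℤ.* P) ℤ.* (κ ℤ.* P) ℤ.+ + 2 ℤ.* M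
                           ℤ.- + 2 ℤ.* L ℤ.* (κ ℤ.* P) ℤ.- + 2 ℤ.* κ ℤ.* (κ ℤ.* P) ℤ.* M)
                  l≡κ-1 (movingEdges-suc-ℤ m))) ⟩
    denominator ℤ.* (+ 2 ℤ.* κ ℤ.* κ ℤ.* T ℤ.+ + 2 ℤ.* (κ ℤ.- + 1) ℤ.* κ ℤ.* (κ ℤ.* P) ℤ.* (κ ℤ.* P)
                     ℤ.+ + 2 ℤ.* ((κ ℤ.- + 1) ℤ.* (+ 2 ℤ.* P)) ℤ.- + 2 ℤ.* (κ ℤ.- + 1) ℤ.* (κ ℤ.* P)
                     ℤ.- + 2 ℤ.* κ ℤ.* (κ ℤ.* P) ℤ.* ((κ ℤ.- + 1) ℤ.* (+ 2 ℤ.* P)))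
      ≡⟨ split-off κ P T ⟩
    + 2 ℤ.* κ ℤ.* κ ℤ.* (denominator ℤ.* T) ℤ.+ denominator ℤ.* rest κ P
      ≡⟨ cong (λ z → + 2 ℤ.* κ ℤ.* κ ℤ.* z ℤ.+ denominator ℤ.* rest κ P) (closed-form m) ⟩
    + 2 ℤ.* κ ℤ.* κ ℤ.* (+ 2 ℤ.* closedForm (suc m)) ℤ.+ denominator ℤ.* rest κ P
      ≡⟨ next κ ((+ 2) ℤ.^ m) P ⟩
    + 2 ℤ.* closedForm (suc (suc m)) ∎
    where
    T = + totalDist (suc m)
    P = κ ℤ.^ m
    rest : ℤ → ℤ → ℤ
    rest k P = + 2 ℤ.* (k ℤ.- + 1) ℤ.* k ℤ.* (k ℤ.* P) ℤ.* (k ℤ.* P) ℤ.+ + 2 ℤ.* ((k ℤ.- + 1) ℤ.* (+ 2 ℤ.* P))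
               ℤ.- + 2 ℤ.* (k ℤ.- + 1) ℤ.* (k ℤ.* P) ℤ.- + 2 ℤ.* k ℤ.* (k ℤ.* P) ℤ.* ((k ℤ.- + 1) ℤ.* (+ 2 ℤ.* P))
    split-off : ∀ k P T →
      k ℤ.* k ℤ.* k ℤ.* (+ 2 ℤ.* k ℤ.- + 1) ℤ.*
        (+ 2 ℤ.* k ℤ.* k ℤ.* T ℤ.+ + 2 ℤ.* (k ℤ.- + 1) ℤ.* k ℤ.* (k ℤ.* P) ℤ.* (k ℤ.* P)
         ℤ.+ + 2 ℤ.* ((k ℤ.- + 1) ℤ.* (+ 2 ℤ.* P)) ℤ.- + 2 ℤ.* (k ℤ.- + 1) ℤ.* (k ℤ.* P)
         ℤ.- + 2 ℤ.* k ℤ.* (k ℤ.* P) ℤ.* ((k ℤ.- + 1) ℤ.* (+ 2 ℤ.* P)))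
      ≡ + 2 ℤ.* k ℤ.* k ℤ.* (k ℤ.* k ℤ.* k ℤ.* (+ 2 ℤ.* k ℤ.- + 1) ℤ.* T)
        ℤ.+ k ℤ.* k ℤ.* k ℤ.* (+ 2 ℤ.* k ℤ.- + 1) ℤ.*
          (+ 2 ℤ.* (k ℤ.- + 1) ℤ.* k ℤ.* (k ℤ.* P) ℤ.* (k ℤ.* P) ℤ.+ + 2 ℤ.* ((k ℤ.- + 1) ℤ.* (+ 2 ℤ.* P))
           ℤ.- + 2 ℤ.* (k ℤ.- + 1) ℤ.* (k ℤ.* P) ℤ.- + 2 ℤ.* k ℤ.* (k ℤ.* P) ℤ.* ((k ℤ.- + 1) ℤ.* (+ 2 ℤ.* P)))
    split-off = ℤ-Solver.solve-∀
    next : ∀ k X P →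
      + 2 ℤ.* k ℤ.* k ℤ.*
        (+ 2 ℤ.* ((k ℤ.- + 1) ℤ.* ((k ℤ.- + 1) ℤ.* + 1) ℤ.* (+ 2 ℤ.* (k ℤ.* (k ℤ.* + 1)) ℤ.- + 2 ℤ.* k ℤ.- + 1)
                    ℤ.* (+ 2 ℤ.* X ℤ.* (k ℤ.* P) ℤ.* (k ℤ.* P))
                  ℤ.- (k ℤ.- + 1) ℤ.* (k ℤ.- + 2) ℤ.* (k ℤ.* (+ 2 ℤ.* k ℤ.- + 1)) ℤ.* ((k ℤ.* P) ℤ.* (k ℤ.* P))
                  ℤ.+ (k ℤ.- + 1) ℤ.* (k ℤ.- + 2) ℤ.* k ℤ.* (k ℤ.* P)))
      ℤ.+ k ℤ.* k ℤ.* k ℤ.* (+ 2 ℤ.* k ℤ.- + 1) ℤ.*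
          (+ 2 ℤ.* (k ℤ.- + 1) ℤ.* k ℤ.* (k ℤ.* P) ℤ.* (k ℤ.* P) ℤ.+ + 2 ℤ.* ((k ℤ.- + 1) ℤ.* (+ 2 ℤ.* P))
           ℤ.- + 2 ℤ.* (k ℤ.- + 1) ℤ.* (k ℤ.* P) ℤ.- + 2 ℤ.* k ℤ.* (k ℤ.* P) ℤ.* ((k ℤ.- + 1) ℤ.* (+ 2 ℤ.* P)))
      ≡ + 2 ℤ.* ((k ℤ.- + 1) ℤ.* ((k ℤ.- + 1) ℤ.* + 1) ℤ.* (+ 2 ℤ.* (k ℤ.* (k ℤ.* + 1)) ℤ.- + 2 ℤ.* k ℤ.- + 1)
                   ℤ.* (+ 2 ℤ.* (+ 2 ℤ.* X) ℤ.* (k ℤ.* (k ℤ.* P)) ℤ.* (k ℤ.* (k ℤ.* P)))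
                 ℤ.- (k ℤ.- + 1) ℤ.* (k ℤ.- + 2) ℤ.* (k ℤ.* (+ 2 ℤ.* k ℤ.- + 1)) ℤ.* ((k ℤ.* (k ℤ.* P)) ℤ.* (k ℤ.* (k ℤ.* P)))
                 ℤ.+ (k ℤ.- + 1) ℤ.* (k ℤ.- + 2) ℤ.* k ℤ.* (k ℤ.* (k ℤ.* P)))
    next = ℤ-Solver.solve-∀

  wiener-identity : ∀ n → 1 ≤ n →
    + (K ^ 3 * t) ℤ.* + wiener K n dist
    ≡ a₁ ℤ.* + (2 ^ n * K ^ (2 * n)) ℤ.- a₂ ℤ.* + (K * t) ℤ.* + (K ^ (2 * n)) ℤ.+ a₂ ℤ.* κ ℤ.* + (K ^ n)
  wiener-identity n@(suc m) _ = ℤ.*-cancelˡ-≡ (+ 2) _ _ (begin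
    + 2 ℤ.* (+ (K ^ 3 * t) ℤ.* + W)            ≡⟨ ℤ.*-comm (+ 2) _ ⟩
    + (K ^ 3 * t) ℤ.* + W ℤ.* + 2              ≡⟨ ℤ.*-assoc (+ (K ^ 3 * t)) (+ W) (+ 2) ⟩
    + (K ^ 3 * t) ℤ.* (+ W ℤ.* + 2)            ≡⟨ cong₂ ℤ._*_ D≡ (trans (sym (ℤ.pos-* W 2))
                                                    (cong +_ (trans (*-comm W 2) (2*wiener≡totalDist n)))) ⟩
    denominator ℤ.* + totalDist n              ≡⟨ closed-form m ⟩
    + 2 ℤ.* closedForm n                       ≡⟨ cong (+ 2 ℤ.*_) (cong₃ X₁≡ E≡ X₂≡ X₃≡) ⟨
    + 2 ℤ.* (a₁ ℤ.* + (2 ^ n * K ^ (2 * n)) ℤ.- a₂ ℤ.* + (K * t) ℤ.* + (K ^ (2 * n)) ℤ.+ a₂ ℤ.* κ ℤ.* + (K ^ n)) ∎)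
    where
    W = wiener K n dist
    t≡ : + t ≡ + 2 ℤ.* κ ℤ.- + 1
    t≡ = double-minus-one (+ l)
      where
      double-minus-one : ∀ L → L ℤ.+ (+ 1 ℤ.+ (L ℤ.+ + 0)) ≡ + 2 ℤ.* (+ 1 ℤ.+ L) ℤ.- + 1
      double-minus-one = ℤ-Solver.solve-∀
    D≡ : + (K ^ 3 * t) ≡ denominator
    D≡ = trans (ℤ.pos-* (K ^ 3) t) (trans (cong₂ ℤ._*_ (pos-^ K 3) t≡) (cube κ (+ 2 ℤ.* κ ℤ.- + 1)))
      where
      cube : ∀ k u → k ℤ.* (k ℤ.* (k ℤ.* + 1)) ℤ.* u ≡ k ℤ.* k ℤ.* k ℤ.* u
      cube = ℤ-Solver.solve-∀
    E≡ : + (K * t) ≡ κ ℤ.* (+ 2 ℤ.* κ ℤ.- + 1)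
    E≡ = trans (ℤ.pos-* K t) (cong (κ ℤ.*_) t≡)
    square : ∀ j → + (j ^ (2 * n)) ≡ (+ j) ℤ.^ n ℤ.* (+ j) ℤ.^ n
    square j = begin
      + (j ^ (n + (n + 0)))     ≡⟨ cong (λ e → + (j ^ (n + e))) (+-identityʳ n) ⟩
      + (j ^ (n + n))           ≡⟨ cong +_ (^-distribˡ-+-* j n n) ⟩
      + (j ^ n * j ^ n)         ≡⟨ ℤ.pos-* (j ^ n) (j ^ n) ⟩
      + (j ^ n) ℤ.* + (j ^ n)   ≡⟨ cong₂ ℤ._*_ (pos-^ j n) (pos-^ j n) ⟩
      (+ j) ℤ.^ n ℤ.* (+ j) ℤ.^ n ∎
    X₂≡ : + (K ^ (2 * n)) ≡ κ ℤ.^ n ℤ.* κ ℤ.^ n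
    X₂≡ = square K
    X₁≡ : + (2 ^ n * K ^ (2 * n)) ≡ (+ 2) ℤ.^ n ℤ.* κ ℤ.^ n ℤ.* κ ℤ.^ n
    X₁≡ = trans (ℤ.pos-* (2 ^ n) (K ^ (2 * n)))
                (trans (cong₂ ℤ._*_ (pos-^ 2 n) X₂≡) (sym (ℤ.*-assoc ((+ 2) ℤ.^ n) (κ ℤ.^ n) (κ ℤ.^ n))))
    X₃≡ : + (K ^ n) ≡ κ ℤ.^ n
    X₃≡ = pos-^ K n
    cong₃ : ∀ {x₁ e x₂ x₃ y₁ f y₂ y₃} → x₁ ≡ y₁ → e ≡ f → x₂ ≡ y₂ → x₃ ≡ y₃ →
      a₁ ℤ.* x₁ ℤ.- a₂ ℤ.* e ℤ.* x₂ ℤ.+ a₂ ℤ.* κ ℤ.* x₃ ≡ a₁ ℤ.* y₁ ℤ.- a₂ ℤ.* f ℤ.* y₂ ℤ.+ a₂ ℤ.* κ ℤ.* y₃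
    cong₃ refl refl refl refl = refl

module _ where

  open import Data.Rational.Unnormalised as ℚᵘ using (mkℚᵘ; *≡*)
  open import Data.Rational.Unnormalised.Properties as ℚᵘ using (≃-trans; ≃-sym)

  private
    toℚᵘ-/ : ∀ i d → toℚᵘ (i / suc d) ℚᵘ.≃ mkℚᵘ i d
    toℚᵘ-/ i d = toℚᵘ-fromℚᵘ (mkℚᵘ i d)

  /1-homo-* : ∀ i j → (i / 1) ℚ.* (j / 1) ≡ (i ℤ.* j) / 1
  /1-homo-* i j = toℚᵘ-injective
    (≃-trans (toℚᵘ-homo-* (i / 1) (j / 1))
    (≃-trans (ℚᵘ.*-cong (toℚᵘ-/ i 0) (toℚᵘ-/ j 0))
    (≃-trans (*≡* refl) (≃-sym (toℚᵘ-/ (i ℤ.* j) 0)))))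

  /1-homo-+ : ∀ i j → (i / 1) ℚ.+ (j / 1) ≡ (i ℤ.+ j) / 1
  /1-homo-+ i j = toℚᵘ-injective
    (≃-trans (toℚᵘ-homo-+ (i / 1) (j / 1))
    (≃-trans (ℚᵘ.+-cong (toℚᵘ-/ i 0) (toℚᵘ-/ j 0))
    (≃-trans (*≡* (cong (ℤ._* + 1) (cong₂ ℤ._+_ (ℤ.*-identityʳ i) (ℤ.*-identityʳ j)))) (≃-sym (toℚᵘ-/ (i ℤ.+ j) 0)))))

  /1-homo-neg : ∀ i → ℚ.- (i / 1) ≡ (ℤ.- i) / 1
  /1-homo-neg i = toℚᵘ-injective
    (≃-trans (toℚᵘ-homo‿- (i / 1))
    (≃-trans (ℚᵘ.-‿cong (toℚᵘ-/ i 0))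
    (≃-trans (*≡* refl) (≃-sym (toℚᵘ-/ (ℤ.- i) 0)))))

  /1-homo-- : ∀ i j → (i / 1) ℚ.- (j / 1) ≡ (i ℤ.- j) / 1
  /1-homo-- i j = trans (cong ((i / 1) ℚ.+_) (/1-homo-neg j)) (/1-homo-+ i (ℤ.- j))

  /-*-denominator : ∀ i d .{{_ : NonZero d}} → (i / d) ℚ.* (+ d / 1) ≡ i / 1
  /-*-denominator i (suc d) = toℚᵘ-injective
    (≃-trans (toℚᵘ-homo-* (i / suc d) (+ suc d / 1))
    (≃-trans (ℚᵘ.*-cong (toℚᵘ-/ i d) (toℚᵘ-/ (+ suc d) 0))
    (≃-trans (*≡* (trans (ℤ.*-identityʳ _) (cong (i ℤ.*_) (cong +_ (sym (*-identityʳ (suc d)))))))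
             (≃-sym (toℚᵘ-/ i 0)))))

  *-cancelʳ-by-inverse : ∀ {p q d r : ℚ} → d ℚ.* r ≡ ℚ.1ℚ → p ℚ.* d ≡ q ℚ.* d → p ≡ q
  *-cancelʳ-by-inverse {p} {q} {d} {r} d*r≡1 p*d≡q*d = begin
    p                   ≡⟨ ℚ.*-identityʳ p ⟨
    p ℚ.* ℚ.1ℚ          ≡⟨ cong (p ℚ.*_) d*r≡1 ⟨
    p ℚ.* (d ℚ.* r)     ≡⟨ ℚ.*-assoc p d r ⟨
    p ℚ.* d ℚ.* r       ≡⟨ cong (ℚ._* r) p*d≡q*d ⟩
    q ℚ.* d ℚ.* r       ≡⟨ ℚ.*-assoc q d r ⟩
    q ℚ.* (d ℚ.* r)     ≡⟨ cong (q ℚ.*_) d*r≡1 ⟩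
    q ℚ.* ℚ.1ℚ          ≡⟨ ℚ.*-identityʳ q ⟩
    q                   ∎

  /1-homo-pos-* : ∀ m n → (+ (m * n)) / 1 ≡ (+ m / 1) ℚ.* (+ n / 1)
  /1-homo-pos-* m n = trans (cong (_/ 1) (ℤ.pos-* m n)) (sym (/1-homo-* (+ m) (+ n)))

  three-fractions : ∀ (a₁ a₂ w X₁ X₂ X₃ : ℤ) k t
    .{{_ : NonZero (k ^ 3 * t)}} .{{_ : NonZero (k ^ 2)}} .{{_ : NonZero (k ^ 2 * t)}} →
    + (k ^ 3 * t) ℤ.* w ≡ a₁ ℤ.* X₁ ℤ.- a₂ ℤ.* + (k * t) ℤ.* X₂ ℤ.+ a₂ ℤ.* + k ℤ.* X₃ →
    w / 1 ≡ (a₁ / (k ^ 3 * t)) ℚ.* (X₁ / 1) ℚ.- (a₂ / k ^ 2) ℚ.* (X₂ / 1) ℚ.+ (a₂ / (k ^ 2 * t)) ℚ.* (X₃ / 1)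
  three-fractions a₁ a₂ w X₁ X₂ X₃ k t identity =
    sym (*-cancelʳ-by-inverse (trans (ℚ.*-comm D (+ 1 / (k ^ 3 * t))) (/-*-denominator (+ 1) (k ^ 3 * t))) (begin
      (r₁ ℚ.* x₁ ℚ.- r₂ ℚ.* x₂ ℚ.+ r₃ ℚ.* x₃) ℚ.* D
        ≡⟨ distribute r₁ r₂ r₃ x₁ x₂ x₃ D ⟩
      r₁ ℚ.* D ℚ.* x₁ ℚ.- r₂ ℚ.* D ℚ.* x₂ ℚ.+ r₃ ℚ.* D ℚ.* x₃
        ≡⟨ cong₂ ℚ._+_ (cong₂ ℚ._-_ (cong (ℚ._* x₁) (/-*-denominator a₁ (k ^ 3 * t))) (cong (ℚ._* x₂) second))
                       (cong (ℚ._* x₃) third) ⟩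
      (a₁ / 1) ℚ.* x₁ ℚ.- (a₂ / 1) ℚ.* (+ (k * t) / 1) ℚ.* x₂ ℚ.+ (a₂ / 1) ℚ.* (+ k / 1) ℚ.* x₃
        ≡⟨ cong₂ ℚ._+_ (cong₂ ℚ._-_ (/1-homo-* a₁ X₁)
                                    (trans (cong (ℚ._* x₂) (/1-homo-* a₂ (+ (k * t)))) (/1-homo-* (a₂ ℤ.* + (k * t)) X₂)))
                       (trans (cong (ℚ._* x₃) (/1-homo-* a₂ (+ k))) (/1-homo-* (a₂ ℤ.* + k) X₃)) ⟩
      (a₁ ℤ.* X₁) / 1 ℚ.- (a₂ ℤ.* + (k * t) ℤ.* X₂) / 1 ℚ.+ (a₂ ℤ.* + k ℤ.* X₃) / 1
        ≡⟨ trans (cong (ℚ._+ ((a₂ ℤ.* + k ℤ.* X₃) / 1)) (/1-homo-- (a₁ ℤ.* X₁) (a₂ ℤ.* + (k * t) ℤ.* X₂)))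
                 (/1-homo-+ (a₁ ℤ.* X₁ ℤ.- a₂ ℤ.* + (k * t) ℤ.* X₂) (a₂ ℤ.* + k ℤ.* X₃)) ⟩
      (a₁ ℤ.* X₁ ℤ.- a₂ ℤ.* + (k * t) ℤ.* X₂ ℤ.+ a₂ ℤ.* + k ℤ.* X₃) / 1
        ≡⟨ cong (_/ 1) identity ⟨
      (+ (k ^ 3 * t) ℤ.* w) / 1
        ≡⟨ /1-homo-* (+ (k ^ 3 * t)) w ⟨
      D ℚ.* (w / 1)
        ≡⟨ ℚ.*-comm D (w / 1) ⟩
      (w / 1) ℚ.* D ∎))
    where
    D = + (k ^ 3 * t) / 1
    r₁ = a₁ / (k ^ 3 * t)
    r₂ = a₂ / k ^ 2
    r₃ = a₂ / (k ^ 2 * t)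
    x₁ = X₁ / 1
    x₂ = X₂ / 1
    x₃ = X₃ / 1
    split : ∀ {m n} → k ^ 3 * t ≡ m * n → D ≡ (+ m / 1) ℚ.* (+ n / 1)
    split {m} {n} eq = trans (cong (λ d → + d / 1) eq) (/1-homo-pos-* m n)
    second : r₂ ℚ.* D ≡ (a₂ / 1) ℚ.* (+ (k * t) / 1)
    second = begin
      r₂ ℚ.* D                                         ≡⟨ cong (r₂ ℚ.*_) (split {k ^ 2} {k * t} (k³t≡k²·kt k t)) ⟩
      r₂ ℚ.* ((+ (k ^ 2) / 1) ℚ.* (+ (k * t) / 1))     ≡⟨ ℚ.*-assoc r₂ (+ (k ^ 2) / 1) (+ (k * t) / 1) ⟨
      r₂ ℚ.* (+ (k ^ 2) / 1) ℚ.* (+ (k * t) / 1)       ≡⟨ cong (ℚ._* (+ (k * t) / 1)) (/-*-denominator a₂ (k ^ 2)) ⟩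
      (a₂ / 1) ℚ.* (+ (k * t) / 1)                     ∎
    third : r₃ ℚ.* D ≡ (a₂ / 1) ℚ.* (+ k / 1)
    third = begin
      r₃ ℚ.* D                                         ≡⟨ cong (r₃ ℚ.*_) (split {k ^ 2 * t} {k} (k³t≡k²t·k k t)) ⟩
      r₃ ℚ.* ((+ (k ^ 2 * t) / 1) ℚ.* (+ k / 1))       ≡⟨ ℚ.*-assoc r₃ (+ (k ^ 2 * t) / 1) (+ k / 1) ⟨
      r₃ ℚ.* (+ (k ^ 2 * t) / 1) ℚ.* (+ k / 1)         ≡⟨ cong (ℚ._* (+ k / 1)) (/-*-denominator a₂ (k ^ 2 * t)) ⟩
      (a₂ / 1) ℚ.* (+ k / 1)                           ∎
    distribute : ∀ r₁ r₂ r₃ x₁ x₂ x₃ d →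
      (r₁ ℚ.* x₁ ℚ.- r₂ ℚ.* x₂ ℚ.+ r₃ ℚ.* x₃) ℚ.* d ≡ r₁ ℚ.* d ℚ.* x₁ ℚ.- r₂ ℚ.* d ℚ.* x₂ ℚ.+ r₃ ℚ.* d ℚ.* x₃
    distribute = solve 7 (λ r₁ r₂ r₃ x₁ x₂ x₃ d →
      (r₁ :* x₁ :- r₂ :* x₂ :+ r₃ :* x₃) :* d := r₁ :* d :* x₁ :- r₂ :* d :* x₂ :+ r₃ :* d :* x₃) refl
      where open ℚ-Solver

mainTheorem12 : (k : ℕ) → ⦃ _ : NonZero k ⦄ → (n : ℕ) → 1 ≤ n →
    (c : Fin k) (o : Fin k → Bool) →
    Σ[ D ∈ (Word k n → Word k n → ℕ) ]
      (IsDistance (SchreierAdj (StarEdge c o) n) D ×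
       ((+ wiener k n D) / 1 ≡ formula k n))
mainTheorem12 (suc l) n 1≤n c o =
  dist , dist-isDistance-Schreier o n ,
  three-fractions a₁ a₂ (+ wiener K n dist) _ _ _ K t ⦃ nz₁ K ⦄ ⦃ nz₃ K ⦄ ⦃ nz₄ K ⦄ (wiener-identity n 1≤n)
  where
  open Star c
  open ClosedForm c
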